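{- Let $C$ be a self-dual linear Kleinian code of length $n$ without codewords of weight $1$, and let $h(C')$ denote the minimal weight of its shadow $C'$. Then: (i) $C$ has at least $\frac{n}{2}(5-n)$ codewords of weight $2$; (ii) equality holds in (i) if and only if $h(C')=n-2$; (iii) in this case, the number of elements of weight $n-2$ in the shadow $C'$ is $2^{n-3}\cdot n$.
   Context: Let $K=\{0,a,b,c\}$ be the Kleinian four-group. A linear code of length $n$ is a subgroup $C\subseteq K^n$; $\mathrm{wt}(\mathbf{x})$ is the number of nonzero coordinates. Define $x\cdot y\in\mathbb{F}_2$ for $x,y\in K$ by $x\cdot y=1$ iff $x,y$ are nonzero and distinct; $(\mathbf{x},\mathbf{y})=\sum_ix_i\cdot y_i$; $C^\perp=\{\mathbf{x}:(\mathbf{x},\mathbf{y})=0\ \forall \mathbf{y}\in C\}$; $C$ is self-dual if $C=C^\perp$, even if all codewords have even weight. For a self-dual $C$, let $C_0$ be the subcode of even-weight codewords; the shadow is $C'=C_0^\perp\setminus C$ if $C$ is not even and $C'=C$ if $C$ is even; $h(C')=\min\{\mathrm{wt}(\mathbf{x}):\mathbf{x}\in C'\}$. -}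

module Defs where

open import Data.Nat using (ℕ; zero; suc; _+_)
open import Data.Bool using (Bool; true; false; _∧_; _∨_; not; _xor_; if_then_else_)
open import Data.List using (List; []; _∷_; [_]; map; concatMap)
open import Data.Vec using (Vec; []; _∷_; replicate)
open import Data.Product using (_×_; Σ; _,_)
open import Relation.Binary.PropositionalEquality using (_≡_)
open import Function.Bundles using (_⇔_)

data K : Set where
  k0 ka kb kc : K

allK : List K
allK = k0 ∷ ka ∷ kb ∷ kc ∷ []

_⊕_ : K → K → K
k0 ⊕ y  = y
x  ⊕ k0 = x
ka ⊕ ka = k0
ka ⊕ kb = kc
ka ⊕ kc = kb
kb ⊕ ka = kc
kb ⊕ kb = k0
kb ⊕ kc = ka
kc ⊕ ka = kb
kc ⊕ kb = ka
kc ⊕ kc = k0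

-- x · y ∈ F₂ (F₂ = Bool with xor as addition): 1 iff x, y nonzero and distinct
_·K_ : K → K → Bool
k0 ·K _  = false
_  ·K k0 = false
ka ·K ka = false
kb ·K kb = false
kc ·K kc = false
_  ·K _  = true

nonzero : K → Bool
nonzero k0 = false
nonzero _  = true

allVecs : (n : ℕ) → List (Vec K n)
allVecs zero = [ [] ]
allVecs (suc n) = concatMap (λ v → map (λ k → k ∷ v) allK) (allVecs n)

zeroVec : (n : ℕ) → Vec K n
zeroVec n = replicate n k0

_⊕ᵥ_ : {n : ℕ} → Vec K n → Vec K n → Vec K n
[] ⊕ᵥ [] = []
(x ∷ xs) ⊕ᵥ (y ∷ ys) = (x ⊕ y) ∷ (xs ⊕ᵥ ys)

⟨_,_⟩ : {n : ℕ} → Vec K n → Vec K n → Bool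
⟨ [] , [] ⟩ = false
⟨ x ∷ xs , y ∷ ys ⟩ = (x ·K y) xor ⟨ xs , ys ⟩

wt : {n : ℕ} → Vec K n → ℕ
wt [] = 0
wt (x ∷ xs) = (if nonzero x then 1 else 0) + wt xs

evenℕ : ℕ → Bool
evenℕ zero = true
evenℕ (suc n) = not (evenℕ n)

allL : {A : Set} → (A → Bool) → List A → Bool
allL p [] = true
allL p (x ∷ xs) = p x ∧ allL p xs

count : {A : Set} → (A → Bool) → List A → ℕ
count p [] = 0
count p (x ∷ xs) = (if p x then 1 else 0) + count p xs

Subset : ℕ → Set
Subset n = Vec K n → Bool

-- linear code = subgroup of K^n (inverses are automatic since x ⊕ x = 0)
IsLinearCode : {n : ℕ} → Subset n → Set
IsLinearCode {n} C =
  (C (zeroVec n) ≡ true) ×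
  (∀ x y → C x ≡ true → C y ≡ true → C (x ⊕ᵥ y) ≡ true)

dual : {n : ℕ} → Subset n → Subset n
dual {n} C x = allL (λ y → not (C y) ∨ not ⟨ x , y ⟩) (allVecs n)

IsSelfDual : {n : ℕ} → Subset n → Set
IsSelfDual C = ∀ x → C x ≡ dual C x

isEven : {n : ℕ} → Subset n → Bool
isEven {n} C = allL (λ x → not (C x) ∨ evenℕ (wt x)) (allVecs n)

evenSubcode : {n : ℕ} → Subset n → Subset n
evenSubcode C x = C x ∧ evenℕ (wt x)

shadow : {n : ℕ} → Subset n → Subset n
shadow C x = if isEven C then C x else (dual (evenSubcode C) x ∧ not (C x))

numOfWeight : {n : ℕ} → Subset n → ℕ → ℕ
numOfWeight {n} S w = count (λ x → S x ∧ (wt x Data.Nat.≡ᵇ w)) (allVecs n)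

MinWeightIs : {n : ℕ} → Subset n → ℕ → Set
MinWeightIs S w =
  Σ _ (λ x → (S x ≡ true) × (wt x ≡ w)) ×
  (∀ x → S x ≡ true → w Data.Nat.≤ wt x)

module Submission where

-- Write χ x y = (-1) ^ ⟨ x , y ⟩, s x = (-1) ^ wt x and z y for the number of zero coordinates
-- of y. Orthogonality of characters and self-duality give |C| = 2 ^ n and, for the shadow S,
-- |C| · 1_S(y) = Σ_{x ∈ C} s x · χ x y (for odd C because 1_C₀ = 1_C · (1 + s) / 2). Hence
-- summing a weight W over S amounts to summing s · Ŵ over C, where Ŵ x = Σ_t W t · χ x t.
-- For W = 1, z and z (z - 1) the transform Ŵ x vanishes once wt x > 2, so since C has no words
-- of weight 1 these moments of z over S are determined by n and the number A₂ of weight-2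
-- codewords; W = s gives Σ_S s = (-2) ^ n = (-1) ^ n |S|, so z is even on S. Then
-- Σ_S z (z - 2) ≥ 0, and this sum equals 2 ^ n (2 A₂ - n (5 - n)) / 16, which gives (i); equality forces z ∈ {0, 2} on S,
-- which is h(S) = n - 2, and then Σ_S z = 2 · #{y ∈ S : wt y = n - 2} gives (iii).

module KleinianShadow where

  open import Defs
  open import Algebra.Bundles using (CommutativeRing)
  open import Data.Bool using (Bool; true; false; not; _∧_; _∨_; _xor_; if_then_else_)
  import Data.Bool as Bool
  open import Data.Bool.Properties
    using (xor-∧-commutativeRing; not-involutive; ∧-conicalˡ; ∧-conicalʳ; T-≡)
  open import Data.Empty using (⊥-elim)
  open import Data.Integer using (ℤ; +_; -_; _+_; _-_; _*_; _^_; _≤_; _<_; +≤+; +<+)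
  import Data.Integer as ℤ
  import Data.Integer.Properties as ℤ
  open import Data.Integer.Tactic.RingSolver using (solve-∀)
  open import Data.List using (List; []; _∷_; _++_; map; concatMap)
  open import Data.List.Membership.Propositional using (_∈_)
  open import Data.List.Membership.Propositional.Properties using (∈-map⁺; ∈-concatMap⁺)
  open import Data.List.Relation.Unary.Any using (here; there)
  import Data.List.Relation.Unary.Any as Any
  open import Data.Nat using (ℕ; zero; suc; _∸_; z≤n; s≤s)
  import Data.Nat as ℕ
  import Data.Nat.Properties as ℕ
  open import Data.Product using (Σ; ∃; _,_; _×_; proj₁; proj₂)
  open import Data.Sum using (_⊎_; inj₁; inj₂; [_,_]′)
  open import Data.Vec using (Vec; []; _∷_)
  open import Function.Base using (_∘_; id)
  open import Function.Bundles using (Equivalence)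
  open import Relation.Binary.Definitions using (tri<; tri≈; tri>)
  open import Relation.Binary.PropositionalEquality
  open import Relation.Nullary using (Dec; yes; no)
  open import Relation.Nullary.Decidable using (from-yes)
  open import Algebra.Properties.CommutativeSemigroup
    (CommutativeRing.+-commutativeSemigroup xor-∧-commutativeRing)
    using () renaming (interchange to xor-interchange)

  ∀K? : {P : K → Set} → (∀ k → Dec (P k)) → Dec (∀ k → P k)
  ∀K? P? with P? k0 | P? ka | P? kb | P? kc
  ... | yes p0 | yes pa | yes pb | yes pc = yes λ { k0 → p0 ; ka → pa ; kb → pb ; kc → pc }
  ... | no ¬p0 | _      | _      | _      = no λ p → ¬p0 (p k0)
  ... | yes _  | no ¬pa | _      | _      = no λ p → ¬pa (p ka)
  ... | yes _  | yes _  | no ¬pb | _      = no λ p → ¬pb (p kb)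
  ... | yes _  | yes _  | yes _  | no ¬pc = no λ p → ¬pc (p kc)

  ⊕-involutive : ∀ a x → (x ⊕ a) ⊕ a ≡ x
  ⊕-involutive k0 k0 = refl
  ⊕-involutive k0 ka = refl
  ⊕-involutive k0 kb = refl
  ⊕-involutive k0 kc = refl
  ⊕-involutive ka k0 = refl
  ⊕-involutive ka ka = refl
  ⊕-involutive ka kb = refl
  ⊕-involutive ka kc = refl
  ⊕-involutive kb k0 = refl
  ⊕-involutive kb ka = refl
  ⊕-involutive kb kb = refl
  ⊕-involutive kb kc = refl
  ⊕-involutive kc k0 = refl
  ⊕-involutive kc ka = refl
  ⊕-involutive kc kb = refl
  ⊕-involutive kc kc = refl

  ·K-comm : ∀ x y → x ·K y ≡ y ·K x
  ·K-comm = from-yes (∀K? λ x → ∀K? λ y → x ·K y Bool.≟ y ·K x)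

  ·K-distribʳ-⊕ : ∀ x a y → (x ⊕ a) ·K y ≡ (x ·K y) xor (a ·K y)
  ·K-distribʳ-⊕ = from-yes (∀K? λ x → ∀K? λ a → ∀K? λ y →
    (x ⊕ a) ·K y Bool.≟ (x ·K y) xor (a ·K y))

  nonzero-⊕ : ∀ x y → nonzero (x ⊕ y) ≡ (nonzero x xor nonzero y) xor (x ·K y)
  nonzero-⊕ = from-yes (∀K? λ x → ∀K? λ y →
    nonzero (x ⊕ y) Bool.≟ (nonzero x xor nonzero y) xor (x ·K y))

  ⊕ᵥ-involutive : ∀ {n} (a x : Vec K n) → (x ⊕ᵥ a) ⊕ᵥ a ≡ x
  ⊕ᵥ-involutive [] [] = refl
  ⊕ᵥ-involutive (a ∷ as) (x ∷ xs) = cong₂ _∷_ (⊕-involutive a x) (⊕ᵥ-involutive as xs)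

  ⟨⟩-comm : ∀ {n} (x y : Vec K n) → ⟨ x , y ⟩ ≡ ⟨ y , x ⟩
  ⟨⟩-comm [] [] = refl
  ⟨⟩-comm (x ∷ xs) (y ∷ ys) = cong₂ _xor_ (·K-comm x y) (⟨⟩-comm xs ys)

  ⟨⟩-distribʳ-⊕ᵥ : ∀ {n} (x a y : Vec K n) → ⟨ x ⊕ᵥ a , y ⟩ ≡ ⟨ x , y ⟩ xor ⟨ a , y ⟩
  ⟨⟩-distribʳ-⊕ᵥ [] [] [] = refl
  ⟨⟩-distribʳ-⊕ᵥ (x ∷ xs) (a ∷ as) (y ∷ ys) =
    trans (cong₂ _xor_ (·K-distribʳ-⊕ x a y) (⟨⟩-distribʳ-⊕ᵥ xs as ys))
          (xor-interchange (x ·K y) (a ·K y) ⟨ xs , ys ⟩ ⟨ as , ys ⟩)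

  oddWt : ∀ {n} → Vec K n → Bool
  oddWt [] = false
  oddWt (x ∷ xs) = nonzero x xor oddWt xs

  -- the weight is a quadratic form whose polarisation is the inner product
  oddWt-⊕ᵥ : ∀ {n} (x y : Vec K n) → oddWt (x ⊕ᵥ y) ≡ (oddWt x xor oddWt y) xor ⟨ x , y ⟩
  oddWt-⊕ᵥ [] [] = refl
  oddWt-⊕ᵥ (x ∷ xs) (y ∷ ys) = begin
    nonzero (x ⊕ y) xor oddWt (xs ⊕ᵥ ys)
      ≡⟨ cong₂ _xor_ (nonzero-⊕ x y) (oddWt-⊕ᵥ xs ys) ⟩
    ((nx xor ny) xor x ·K y) xor ((oddWt xs xor oddWt ys) xor ⟨ xs , ys ⟩)
      ≡⟨ xor-interchange (nx xor ny) (x ·K y) (oddWt xs xor oddWt ys) ⟨ xs , ys ⟩ ⟩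
    ((nx xor ny) xor (oddWt xs xor oddWt ys)) xor (x ·K y xor ⟨ xs , ys ⟩)
      ≡⟨ cong (_xor (x ·K y xor ⟨ xs , ys ⟩)) (xor-interchange nx ny (oddWt xs) (oddWt ys)) ⟩
    ((nx xor oddWt xs) xor (ny xor oddWt ys)) xor (x ·K y xor ⟨ xs , ys ⟩) ∎
    where
    open ≡-Reasoning
    nx ny : Bool
    nx = nonzero x
    ny = nonzero y

  evenℕ-wt : ∀ {n} (x : Vec K n) → evenℕ (wt x) ≡ not (oddWt x)
  evenℕ-wt [] = refl
  evenℕ-wt (k0 ∷ xs) = evenℕ-wt xs
  evenℕ-wt (ka ∷ xs) = cong not (evenℕ-wt xs)
  evenℕ-wt (kb ∷ xs) = cong not (evenℕ-wt xs)
  evenℕ-wt (kc ∷ xs) = cong not (evenℕ-wt xs)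

  oddWt≡not-evenℕ-wt : ∀ {n} (x : Vec K n) → oddWt x ≡ not (evenℕ (wt x))
  oddWt≡not-evenℕ-wt x = trans (sym (not-involutive (oddWt x))) (cong not (sym (evenℕ-wt x)))

  evenℕ-wt⇒¬oddWt : ∀ {n} (x : Vec K n) → evenℕ (wt x) ≡ true → oddWt x ≡ false
  evenℕ-wt⇒¬oddWt x e = trans (oddWt≡not-evenℕ-wt x) (cong not e)

  wt≡0⇒≡zeroVec : ∀ {n} (x : Vec K n) → wt x ≡ 0 → x ≡ zeroVec n
  wt≡0⇒≡zeroVec [] _ = refl
  wt≡0⇒≡zeroVec (k0 ∷ xs) e = cong (k0 ∷_) (wt≡0⇒≡zeroVec xs e)

  wt-zeroVec : ∀ n → wt (zeroVec n) ≡ 0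
  wt-zeroVec zero = refl
  wt-zeroVec (suc n) = wt-zeroVec n

  zeros : ∀ {n} → Vec K n → ℕ
  zeros [] = 0
  zeros (x ∷ xs) = (if nonzero x then 0 else 1) ℕ.+ zeros xs

  wt+zeros≡length : ∀ {n} (x : Vec K n) → wt x ℕ.+ zeros x ≡ n
  wt+zeros≡length [] = refl
  wt+zeros≡length (k0 ∷ xs) = trans (ℕ.+-suc (wt xs) (zeros xs)) (cong suc (wt+zeros≡length xs))
  wt+zeros≡length (ka ∷ xs) = cong suc (wt+zeros≡length xs)
  wt+zeros≡length (kb ∷ xs) = cong suc (wt+zeros≡length xs)
  wt+zeros≡length (kc ∷ xs) = cong suc (wt+zeros≡length xs)

  wt≡length∸zeros : ∀ {n} (y : Vec K n) → wt y ≡ n ∸ zeros y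
  wt≡length∸zeros y = trans (sym (ℕ.m+n∸n≡m (wt y) (zeros y))) (cong (_∸ zeros y) (wt+zeros≡length y))

  zeros≤2⇒length∸2≤wt : ∀ {n} (y : Vec K n) → zeros y ℕ.≤ 2 → n ∸ 2 ℕ.≤ wt y
  zeros≤2⇒length∸2≤wt {n} y z≤2 = ℕ.m≤n+o⇒m∸n≤o n 2 (begin
    n                ≡⟨ wt+zeros≡length y ⟨
    wt y ℕ.+ zeros y ≤⟨ ℕ.+-monoʳ-≤ (wt y) z≤2 ⟩
    wt y ℕ.+ 2       ≡⟨ ℕ.+-comm (wt y) 2 ⟩
    2 ℕ.+ wt y       ∎)
    where open ℕ.≤-Reasoning

  length∸2≤wt⇒zeros≤2 : ∀ {n} (y : Vec K n) → n ∸ 2 ℕ.≤ wt y → zeros y ℕ.≤ 2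
  length∸2≤wt⇒zeros≤2 {n} y n∸2≤wt = ℕ.+-cancelˡ-≤ (wt y) (zeros y) 2 (begin
    wt y ℕ.+ zeros y ≡⟨ wt+zeros≡length y ⟩
    n                ≤⟨ ℕ.m≤n+m∸n n 2 ⟩
    2 ℕ.+ (n ∸ 2)    ≤⟨ ℕ.+-monoʳ-≤ 2 n∸2≤wt ⟩
    2 ℕ.+ wt y       ≡⟨ ℕ.+-comm 2 (wt y) ⟩
    wt y ℕ.+ 2       ∎)
    where open ℕ.≤-Reasoning

  minWeight⇒zeros≤2 : ∀ {n} (S : Subset n) → MinWeightIs S (n ∸ 2) → ∀ y → S y ≡ true → zeros y ℕ.≤ 2
  minWeight⇒zeros≤2 S (_ , n∸2≤wt) y y∈S = length∸2≤wt⇒zeros≤2 y (n∸2≤wt y y∈S)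

  sgn : Bool → ℤ
  sgn false = + 1
  sgn true = - + 1

  sgn-xor : ∀ a b → sgn (a xor b) ≡ sgn a * sgn b
  sgn-xor false false = refl
  sgn-xor false true = refl
  sgn-xor true false = refl
  sgn-xor true true = refl

  sgn-not : ∀ a → sgn (not a) ≡ - sgn a
  sgn-not false = refl
  sgn-not true = refl

  sgn*sgn≡1 : ∀ a → sgn a * sgn a ≡ + 1
  sgn*sgn≡1 false = refl
  sgn*sgn≡1 true = refl

  sgnℕ : ℕ → ℤ
  sgnℕ m = sgn (not (evenℕ m))

  sgnℕ-+ : ∀ a b → sgnℕ (a ℕ.+ b) ≡ sgnℕ a * sgnℕ b
  sgnℕ-+ zero b = sym (ℤ.*-identityˡ (sgnℕ b))
  sgnℕ-+ (suc a) b = begin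
    sgn (not (not (evenℕ (a ℕ.+ b))))   ≡⟨ sgn-not (not (evenℕ (a ℕ.+ b))) ⟩
    - sgnℕ (a ℕ.+ b)                    ≡⟨ cong -_ (sgnℕ-+ a b) ⟩
    - (sgnℕ a * sgnℕ b)                 ≡⟨ ℤ.neg-distribˡ-* (sgnℕ a) (sgnℕ b) ⟩
    - sgnℕ a * sgnℕ b                   ≡⟨ cong (_* sgnℕ b) (sgn-not (not (evenℕ a))) ⟨
    sgnℕ (suc a) * sgnℕ b               ∎
    where open ≡-Reasoning

  𝟙 : Bool → ℤ
  𝟙 true = + 1
  𝟙 false = + 0

  0≤𝟙 : ∀ b → + 0 ≤ 𝟙 b
  0≤𝟙 true = +≤+ z≤n
  0≤𝟙 false = +≤+ z≤n

  𝟙-∧-not : ∀ a b → (b ≡ true → a ≡ true) → 𝟙 (a ∧ not b) ≡ 𝟙 a - 𝟙 b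
  𝟙-∧-not true false _ = refl
  𝟙-∧-not false false _ = refl
  𝟙-∧-not a true b⇒a rewrite b⇒a refl = refl

  χ : ∀ {n} → Vec K n → Vec K n → ℤ
  χ x y = sgn ⟨ x , y ⟩

  χ-⊕ᵥ : ∀ {n} (x a y : Vec K n) → χ (x ⊕ᵥ a) y ≡ χ x y * χ a y
  χ-⊕ᵥ x a y = trans (cong sgn (⟨⟩-distribʳ-⊕ᵥ x a y)) (sgn-xor ⟨ x , y ⟩ ⟨ a , y ⟩)

  sgnWt : ∀ {n} → Vec K n → ℤ
  sgnWt x = sgn (oddWt x)

  sgnWt-⊕ᵥ : ∀ {n} (x a : Vec K n) → sgnWt (x ⊕ᵥ a) ≡ sgnWt x * sgnWt a * χ x a
  sgnWt-⊕ᵥ x a = begin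
    sgn (oddWt (x ⊕ᵥ a))                           ≡⟨ cong sgn (oddWt-⊕ᵥ x a) ⟩
    sgn ((oddWt x xor oddWt a) xor ⟨ x , a ⟩)      ≡⟨ sgn-xor (oddWt x xor oddWt a) ⟨ x , a ⟩ ⟩
    sgn (oddWt x xor oddWt a) * χ x a              ≡⟨ cong (_* χ x a) (sgn-xor (oddWt x) (oddWt a)) ⟩
    sgnWt x * sgnWt a * χ x a                      ∎
    where open ≡-Reasoning

  sgnWt-even : ∀ {n} (x : Vec K n) → evenℕ (wt x) ≡ true → sgnWt x ≡ + 1
  sgnWt-even x e = cong sgn (evenℕ-wt⇒¬oddWt x e)

  sgnWt≡sgnℕ-wt : ∀ {n} (x : Vec K n) → sgnWt x ≡ sgnℕ (wt x)
  sgnWt≡sgnℕ-wt x = cong sgn (oddWt≡not-evenℕ-wt x)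

  sgnℕ-zeros : ∀ {n} (x : Vec K n) → sgnℕ n * sgnWt x ≡ sgnℕ (zeros x)
  sgnℕ-zeros {n} x = begin
    sgnℕ n * sgnWt x                        ≡⟨ cong₂ _*_ (cong sgnℕ (sym (wt+zeros≡length x))) (sgnWt≡sgnℕ-wt x) ⟩
    sgnℕ (w ℕ.+ z) * sgnℕ w                 ≡⟨ cong (_* sgnℕ w) (sgnℕ-+ w z) ⟩
    sgnℕ w * sgnℕ z * sgnℕ w                ≡⟨ reorder (sgnℕ w) (sgnℕ z) ⟩
    sgnℕ w * sgnℕ w * sgnℕ z                ≡⟨ cong (_* sgnℕ z) (sgn*sgn≡1 (not (evenℕ w))) ⟩
    + 1 * sgnℕ z                            ≡⟨ ℤ.*-identityˡ (sgnℕ z) ⟩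
    sgnℕ z                                  ∎
    where
    open ≡-Reasoning
    w z : ℕ
    w = wt x
    z = zeros x
    reorder : ∀ a b → a * b * a ≡ a * a * b
    reorder = solve-∀

  zeros-∷ : ∀ k {n} (v : Vec K n) → + zeros (k ∷ v) ≡ 𝟙 (not (nonzero k)) + + zeros v
  zeros-∷ k0 v = ℤ.pos-+ 1 (zeros v)
  zeros-∷ ka v = sym (ℤ.+-identityˡ _)
  zeros-∷ kb v = sym (ℤ.+-identityˡ _)
  zeros-∷ kc v = sym (ℤ.+-identityˡ _)

  pos-^ : ∀ m n → (+ m) ^ n ≡ + (m ℕ.^ n)
  pos-^ m zero = refl
  pos-^ m (suc n) = trans (cong (+ m *_) (pos-^ m n)) (sym (ℤ.pos-* m (m ℕ.^ n)))

  0<2^n : ∀ n → + 0 < (+ 2) ^ n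
  0<2^n n = subst (+ 0 <_) (sym (pos-^ 2 n)) (+<+ (ℕ.m^n>0 2 n))

  2^n*-cancelˡ-≡ : ∀ n {i j} → (+ 2) ^ n * i ≡ (+ 2) ^ n * j → i ≡ j
  2^n*-cancelˡ-≡ n {i} {j} = ℤ.*-cancelˡ-≡ ((+ 2) ^ n) i j {{ℤ.>-nonZero (0<2^n n)}}

  4^n≡2^n*2^n : ∀ n → (+ 4) ^ n ≡ (+ 2) ^ n * (+ 2) ^ n
  4^n≡2^n*2^n zero = refl
  4^n≡2^n*2^n (suc n) = trans (cong (+ 4 *_) (4^n≡2^n*2^n n)) (square-double ((+ 2) ^ n))
    where
    square-double : ∀ p → + 4 * (p * p) ≡ (+ 2 * p) * (+ 2 * p)
    square-double = solve-∀

  -2^n≡sgnℕ*2^n : ∀ n → (- + 2) ^ n ≡ sgnℕ n * (+ 2) ^ n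
  -2^n≡sgnℕ*2^n zero = refl
  -2^n≡sgnℕ*2^n (suc n) = begin
    - + 2 * (- + 2) ^ n               ≡⟨ cong (- + 2 *_) (-2^n≡sgnℕ*2^n n) ⟩
    - + 2 * (sgnℕ n * (+ 2) ^ n)      ≡⟨ flip (sgnℕ n) ((+ 2) ^ n) ⟩
    - sgnℕ n * (+ 2 * (+ 2) ^ n)      ≡⟨ cong (_* (+ 2) ^ suc n) (sgn-not (not (evenℕ n))) ⟨
    sgnℕ (suc n) * (+ 2) ^ suc n      ∎
    where
    open ≡-Reasoning
    flip : ∀ s p → - + 2 * (s * p) ≡ - s * (+ 2 * p)
    flip = solve-∀

  m*m≡n*n⇒m≡n : ∀ m n → m ℕ.* m ≡ n ℕ.* n → m ≡ n
  m*m≡n*n⇒m≡n m n m²≡n² with ℕ.<-cmp m n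
  ... | tri< m<n _ _ = ⊥-elim (ℕ.<⇒≢ (ℕ.*-mono-< m<n m<n) m²≡n²)
  ... | tri≈ _ m≡n _ = m≡n
  ... | tri> _ _ m>n = ⊥-elim (ℕ.<⇒≢ (ℕ.*-mono-< m>n m>n) (sym m²≡n²))

  i*i≡j*j⇒i≡j : ∀ {i j} → + 0 ≤ i → + 0 ≤ j → i * i ≡ j * j → i ≡ j
  i*i≡j*j⇒i≡j {+ m} {+ n} _ _ i²≡j² =
    cong +_ (m*m≡n*n⇒m≡n m n (ℤ.+-injective (trans (ℤ.pos-* m m) (trans i²≡j² (sym (ℤ.pos-* n n))))))

  sumK : (K → ℤ) → ℤ
  sumK f = f k0 + f ka + f kb + f kc

  sum : (n : ℕ) → (Vec K n → ℤ) → ℤ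
  sum zero f = f []
  sum (suc n) f = sum n (λ v → sumK (λ k → f (k ∷ v)))

  sumK-cong : {f g : K → ℤ} → (∀ k → f k ≡ g k) → sumK f ≡ sumK g
  sumK-cong e = cong₂ _+_ (cong₂ _+_ (cong₂ _+_ (e k0) (e ka)) (e kb)) (e kc)

  sumK-+ : (f g : K → ℤ) → sumK (λ k → f k + g k) ≡ sumK f + sumK g
  sumK-+ f g = regroup (f k0) (f ka) (f kb) (f kc) (g k0) (g ka) (g kb) (g kc)
    where
    regroup : ∀ a b c d a′ b′ c′ d′ →
      (a + a′) + (b + b′) + (c + c′) + (d + d′) ≡ (a + b + c + d) + (a′ + b′ + c′ + d′)
    regroup = solve-∀

  sumK-*ˡ : (c : ℤ) (f : K → ℤ) → sumK (λ k → c * f k) ≡ c * sumK f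
  sumK-*ˡ c f = factor c (f k0) (f ka) (f kb) (f kc)
    where
    factor : ∀ c a b d e → c * a + c * b + c * d + c * e ≡ c * (a + b + d + e)
    factor = solve-∀

  sumK-*ʳ : (f : K → ℤ) (c : ℤ) → sumK (λ k → f k * c) ≡ sumK f * c
  sumK-*ʳ f c = factor c (f k0) (f ka) (f kb) (f kc)
    where
    factor : ∀ c a b d e → a * c + b * c + d * c + e * c ≡ (a + b + d + e) * c
    factor = solve-∀

  sumK-translate : (f : K → ℤ) (a : K) → sumK (λ k → f (k ⊕ a)) ≡ sumK f
  sumK-translate f k0 = refl
  sumK-translate f ka = swap₁ (f k0) (f ka) (f kb) (f kc)
    where swap₁ : ∀ p q r s → q + p + s + r ≡ p + q + r + s
          swap₁ = solve-∀
  sumK-translate f kb = swap₂ (f k0) (f ka) (f kb) (f kc)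
    where swap₂ : ∀ p q r s → r + s + p + q ≡ p + q + r + s
          swap₂ = solve-∀
  sumK-translate f kc = swap₃ (f k0) (f ka) (f kb) (f kc)
    where swap₃ : ∀ p q r s → s + r + q + p ≡ p + q + r + s
          swap₃ = solve-∀

  sum-cong : ∀ n {f g : Vec K n → ℤ} → (∀ x → f x ≡ g x) → sum n f ≡ sum n g
  sum-cong zero e = e []
  sum-cong (suc n) e = sum-cong n (λ v → sumK-cong (λ k → e (k ∷ v)))

  sum-+ : ∀ n (f g : Vec K n → ℤ) → sum n (λ x → f x + g x) ≡ sum n f + sum n g
  sum-+ zero f g = refl
  sum-+ (suc n) f g = trans (sum-cong n (λ v → sumK-+ (λ k → f (k ∷ v)) (λ k → g (k ∷ v))))
                            (sum-+ n _ _)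

  sum-*ˡ : ∀ n (c : ℤ) (f : Vec K n → ℤ) → sum n (λ x → c * f x) ≡ c * sum n f
  sum-*ˡ zero c f = refl
  sum-*ˡ (suc n) c f = trans (sum-cong n (λ v → sumK-*ˡ c (λ k → f (k ∷ v)))) (sum-*ˡ n c _)

  sum-*ʳ : ∀ n (f : Vec K n → ℤ) (c : ℤ) → sum n (λ x → f x * c) ≡ sum n f * c
  sum-*ʳ zero f c = refl
  sum-*ʳ (suc n) f c = trans (sum-cong n (λ v → sumK-*ʳ (λ k → f (k ∷ v)) c)) (sum-*ʳ n _ c)

  sum-neg : ∀ n (f : Vec K n → ℤ) → sum n (λ x → - f x) ≡ - sum n f
  sum-neg n f = trans (sum-cong n (λ x → sym (ℤ.-1*i≡-i (f x))))
                      (trans (sum-*ˡ n (- + 1) f) (ℤ.-1*i≡-i (sum n f)))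

  sum-minus : ∀ n (f g : Vec K n → ℤ) → sum n (λ x → f x - g x) ≡ sum n f - sum n g
  sum-minus n f g = trans (sum-+ n f (λ x → - g x)) (cong (_+_ (sum n f)) (sum-neg n g))

  sum-0 : ∀ n → sum n (λ _ → + 0) ≡ + 0
  sum-0 zero = refl
  sum-0 (suc n) = sum-0 n

  sumK-sum : ∀ m (F : K → Vec K m → ℤ) →
    sumK (λ k → sum m (F k)) ≡ sum m (λ y → sumK (λ k → F k y))
  sumK-sum m F = sym (begin
    sum m (λ y → F k0 y + F ka y + F kb y + F kc y)
      ≡⟨ sum-+ m _ (F kc) ⟩
    sum m (λ y → F k0 y + F ka y + F kb y) + sum m (F kc)
      ≡⟨ cong (_+ sum m (F kc)) (sum-+ m _ (F kb)) ⟩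
    sum m (λ y → F k0 y + F ka y) + sum m (F kb) + sum m (F kc)
      ≡⟨ cong (λ s → s + sum m (F kb) + sum m (F kc)) (sum-+ m (F k0) (F ka)) ⟩
    sumK (λ k → sum m (F k)) ∎)
    where open ≡-Reasoning

  sum-swap : ∀ n m (F : Vec K n → Vec K m → ℤ) →
    sum n (λ x → sum m (F x)) ≡ sum m (λ y → sum n (λ x → F x y))
  sum-swap zero m F = refl
  sum-swap (suc n) m F =
    trans (sum-cong n (λ v → sumK-sum m (λ k → F (k ∷ v))))
          (sum-swap n m (λ v y → sumK (λ k → F (k ∷ v) y)))

  sum-translate : ∀ n (f : Vec K n → ℤ) (a : Vec K n) → sum n (λ x → f (x ⊕ᵥ a)) ≡ sum n f
  sum-translate zero f [] = refl
  sum-translate (suc n) f (a ∷ as) =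
    trans (sum-translate n (λ w → sumK (λ k → f ((k ⊕ a) ∷ w))) as)
          (sum-cong n (λ w → sumK-translate (λ k → f (k ∷ w)) a))

  i≤j⇒i≤j+k : ∀ {i j} k → + 0 ≤ k → i ≤ j → i ≤ j + k
  i≤j⇒i≤j+k k 0≤k i≤j = subst (_≤ _) (ℤ.+-identityʳ _) (ℤ.+-mono-≤ i≤j 0≤k)

  i≤j⇒i≤k+j : ∀ {i j} k → + 0 ≤ k → i ≤ j → i ≤ k + j
  i≤j⇒i≤k+j k 0≤k i≤j = subst (_≤ _) (ℤ.+-identityˡ _) (ℤ.+-mono-≤ 0≤k i≤j)

  sumK-term≤ : (f : K → ℤ) → (∀ k → + 0 ≤ f k) → ∀ k → f k ≤ sumK f
  sumK-term≤ f f≥0 k0 = i≤j⇒i≤j+k _ (f≥0 kc) (i≤j⇒i≤j+k _ (f≥0 kb) (i≤j⇒i≤j+k _ (f≥0 ka) ℤ.≤-refl))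
  sumK-term≤ f f≥0 ka = i≤j⇒i≤j+k _ (f≥0 kc) (i≤j⇒i≤j+k _ (f≥0 kb) (i≤j⇒i≤k+j _ (f≥0 k0) ℤ.≤-refl))
  sumK-term≤ f f≥0 kb = i≤j⇒i≤j+k _ (f≥0 kc) (i≤j⇒i≤k+j _ (ℤ.+-mono-≤ (f≥0 k0) (f≥0 ka)) ℤ.≤-refl)
  sumK-term≤ f f≥0 kc =
    i≤j⇒i≤k+j _ (ℤ.+-mono-≤ (ℤ.+-mono-≤ (f≥0 k0) (f≥0 ka)) (f≥0 kb)) ℤ.≤-refl

  sum-term≤ : ∀ n (f : Vec K n → ℤ) → (∀ x → + 0 ≤ f x) → ∀ x → f x ≤ sum n f
  sum-term≤ zero f f≥0 [] = ℤ.≤-refl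
  sum-term≤ (suc n) f f≥0 (k ∷ v) =
    ℤ.≤-trans (sumK-term≤ (λ k → f (k ∷ v)) (λ k → f≥0 (k ∷ v)) k)
              (sum-term≤ n _ sumK≥0 v)
    where
    sumK≥0 : ∀ w → + 0 ≤ sumK (λ k → f (k ∷ w))
    sumK≥0 w = ℤ.≤-trans (f≥0 (k0 ∷ w)) (sumK-term≤ (λ k → f (k ∷ w)) (λ k → f≥0 (k ∷ w)) k0)

  sum-nonneg : ∀ n (f : Vec K n → ℤ) → (∀ x → + 0 ≤ f x) → + 0 ≤ sum n f
  sum-nonneg n f f≥0 = ℤ.≤-trans (f≥0 (zeroVec n)) (sum-term≤ n f f≥0 (zeroVec n))

  sum-nonneg≡0⇒≡0 : ∀ n (f : Vec K n → ℤ) → (∀ x → + 0 ≤ f x) → sum n f ≡ + 0 → ∀ x → f x ≡ + 0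
  sum-nonneg≡0⇒≡0 n f f≥0 Σ≡0 x =
    ℤ.≤-antisym (subst (f x ≤_) Σ≡0 (sum-term≤ n f f≥0 x)) (f≥0 x)

  sum-δ₀ : ∀ n c → sum n (λ x → 𝟙 (wt x ℕ.≡ᵇ 0) * c) ≡ c
  sum-δ₀ zero c = ℤ.*-identityˡ c
  sum-δ₀ (suc n) c = trans (sum-cong n (λ v → drop-zeros _)) (sum-δ₀ n c)
    where
    drop-zeros : ∀ a → a + + 0 + + 0 + + 0 ≡ a
    drop-zeros = solve-∀

  sumList : {A : Set} → (A → ℤ) → List A → ℤ
  sumList f [] = + 0
  sumList f (x ∷ xs) = f x + sumList f xs

  sumList-++ : {A : Set} (f : A → ℤ) (xs ys : List A) →
    sumList f (xs ++ ys) ≡ sumList f xs + sumList f ys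
  sumList-++ f [] ys = sym (ℤ.+-identityˡ _)
  sumList-++ f (x ∷ xs) ys =
    trans (cong (_+_ (f x)) (sumList-++ f xs ys)) (sym (ℤ.+-assoc (f x) _ _))

  sumList-concatMap : {A B : Set} (f : B → ℤ) (g : A → List B) (xs : List A) →
    sumList f (concatMap g xs) ≡ sumList (λ a → sumList f (g a)) xs
  sumList-concatMap f g [] = refl
  sumList-concatMap f g (x ∷ xs) =
    trans (sumList-++ f (g x) (concatMap g xs)) (cong (_+_ (sumList f (g x))) (sumList-concatMap f g xs))

  sumList-cong : {A : Set} {f g : A → ℤ} (xs : List A) → (∀ x → f x ≡ g x) →
    sumList f xs ≡ sumList g xs
  sumList-cong [] e = refl
  sumList-cong (x ∷ xs) e = cong₂ _+_ (e x) (sumList-cong xs e)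

  sum≡sumList-allVecs : ∀ n (f : Vec K n → ℤ) → sum n f ≡ sumList f (allVecs n)
  sum≡sumList-allVecs zero f = sym (ℤ.+-identityʳ _)
  sum≡sumList-allVecs (suc n) f = begin
    sum n (λ v → sumK (λ k → f (k ∷ v)))
      ≡⟨ sum≡sumList-allVecs n _ ⟩
    sumList (λ v → sumK (λ k → f (k ∷ v))) (allVecs n)
      ≡⟨ sumList-cong (allVecs n) (λ v → +0-right (f (k0 ∷ v)) (f (ka ∷ v)) (f (kb ∷ v)) (f (kc ∷ v))) ⟩
    sumList (λ v → sumList f (map (_∷ v) allK)) (allVecs n)
      ≡⟨ sumList-concatMap f (λ v → map (_∷ v) allK) (allVecs n) ⟨
    sumList f (allVecs (suc n)) ∎
    where
    open ≡-Reasoning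
    +0-right : ∀ a b c d → a + b + c + d ≡ a + (b + (c + (d + + 0)))
    +0-right = solve-∀

  count≡sumList : {A : Set} (p : A → Bool) (xs : List A) → + count p xs ≡ sumList (λ x → 𝟙 (p x)) xs
  count≡sumList p [] = refl
  count≡sumList p (x ∷ xs) with p x
  ... | true = trans (ℤ.pos-+ 1 (count p xs)) (cong (_+_ (+ 1)) (count≡sumList p xs))
  ... | false = trans (count≡sumList p xs) (sym (ℤ.+-identityˡ _))

  count-allVecs : ∀ n (p : Vec K n → Bool) → + count p (allVecs n) ≡ sum n (λ x → 𝟙 (p x))
  count-allVecs n p = trans (count≡sumList p (allVecs n)) (sym (sum≡sumList-allVecs n _))

  count≢0⇒∃ : {A : Set} (p : A → Bool) (xs : List A) → count p xs ≢ 0 → ∃ λ x → p x ≡ true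
  count≢0⇒∃ p [] c≢0 = ⊥-elim (c≢0 refl)
  count≢0⇒∃ p (x ∷ xs) c≢0 with p x in px
  ... | true = x , px
  ... | false = count≢0⇒∃ p xs c≢0

  ∈-allK : ∀ k → k ∈ allK
  ∈-allK k0 = here refl
  ∈-allK ka = there (here refl)
  ∈-allK kb = there (there (here refl))
  ∈-allK kc = there (there (there (here refl)))

  ∈-allVecs : ∀ {n} (v : Vec K n) → v ∈ allVecs n
  ∈-allVecs [] = here refl
  ∈-allVecs (k ∷ v) = ∈-concatMap⁺ (λ w → map (_∷ w) allK)
    (Any.map (λ { refl → ∈-map⁺ (_∷ v) (∈-allK k) }) (∈-allVecs v))

  allL-true : {A : Set} (p : A → Bool) {xs : List A} → allL p xs ≡ true →
    ∀ {x} → x ∈ xs → p x ≡ true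
  allL-true p {x ∷ xs} h x∈ with p x in px
  allL-true p {x ∷ xs} h (here refl) | true = px
  allL-true p {x ∷ xs} h (there x∈) | true = allL-true p h x∈

  allL-intro : {A : Set} (p : A → Bool) (xs : List A) → (∀ x → p x ≡ true) → allL p xs ≡ true
  allL-intro p [] h = refl
  allL-intro p (x ∷ xs) h rewrite h x = allL-intro p xs h

  allL-false : {A : Set} (p : A → Bool) (xs : List A) → allL p xs ≡ false → ∃ λ x → p x ≡ false
  allL-false p (x ∷ xs) h with p x in px
  ... | false = x , px
  ... | true = allL-false p xs h

  size : ∀ {n} → Subset n → ℤ
  size {n} D = sum n (λ x → 𝟙 (D x))

  dual⇒orthogonal : ∀ {n} (D : Subset n) y → dual D y ≡ true → ∀ x → D x ≡ true → ⟨ y , x ⟩ ≡ false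
  dual⇒orthogonal {n} D y y∈D⊥ x x∈D with allL-true _ y∈D⊥ (∈-allVecs x)
  ... | x∈D⊥-test rewrite x∈D = notᵀ x∈D⊥-test
    where
    notᵀ : ∀ {b} → not b ≡ true → b ≡ false
    notᵀ {false} _ = refl

  orthogonal⇒dual : ∀ {n} (D : Subset n) y → (∀ x → D x ≡ true → ⟨ y , x ⟩ ≡ false) → dual D y ≡ true
  orthogonal⇒dual {n} D y y⊥D = allL-intro _ (allVecs n) test
    where
    test : ∀ x → not (D x) ∨ not ⟨ y , x ⟩ ≡ true
    test x with D x in x∈D
    ... | false = refl
    ... | true rewrite y⊥D x x∈D = refl

  ¬dual⇒∃ : ∀ {n} (D : Subset n) y → dual D y ≡ false → ∃ λ x → D x ≡ true × ⟨ y , x ⟩ ≡ true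
  ¬dual⇒∃ {n} D y y∉D⊥ with allL-false _ (allVecs n) y∉D⊥
  ... | x , test with D x in x∈D | ⟨ y , x ⟩ in ⟨y,x⟩≡1
  ...   | true | true = x , x∈D , ⟨y,x⟩≡1

  linear-translate : ∀ {n} (D : Subset n) → IsLinearCode D → ∀ {a} → D a ≡ true →
    ∀ x → D (x ⊕ᵥ a) ≡ D x
  linear-translate D (_ , closed) {a} a∈D x with D x in x∈D | D (x ⊕ᵥ a) in x+a∈D
  ... | true | true = refl
  ... | false | false = refl
  ... | true | false = trans (sym x+a∈D) (closed x a x∈D a∈D)
  ... | false | true =
    trans (sym (trans (cong D (sym (⊕ᵥ-involutive a x))) (closed (x ⊕ᵥ a) a x+a∈D a∈D))) x∈D

  sum-antiinvariant : ∀ n (f : Vec K n → ℤ) (a : Vec K n) → (∀ x → f (x ⊕ᵥ a) ≡ - f x) →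
    sum n f ≡ + 0
  sum-antiinvariant n f a f-anti = [ (λ ()) , id ]′ (ℤ.i*j≡0⇒i≡0∨j≡0 (+ 2) 2Σ≡0)
    where
    2Σ≡0 : + 2 * sum n f ≡ + 0
    2Σ≡0 = begin
      + 2 * sum n f                                 ≡⟨ double (sum n f) ⟩
      sum n f + sum n f                             ≡⟨ cong (_+_ (sum n f)) (sum-translate n f a) ⟨
      sum n f + sum n (λ x → f (x ⊕ᵥ a))            ≡⟨ cong (_+_ (sum n f)) (sum-cong n f-anti) ⟩
      sum n f + sum n (λ x → - f x)                 ≡⟨ sum-+ n f _ ⟨
      sum n (λ x → f x - f x)                       ≡⟨ sum-cong n (λ x → ℤ.+-inverseʳ (f x)) ⟩
      sum n (λ _ → + 0)                             ≡⟨ sum-0 n ⟩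
      + 0                                           ∎
      where
      open ≡-Reasoning
      double : ∀ s → + 2 * s ≡ s + s
      double = solve-∀

  χ-orthogonality : ∀ {n} (D : Subset n) → IsLinearCode D → ∀ y →
    sum n (λ x → 𝟙 (D x) * χ x y) ≡ size D * 𝟙 (dual D y)
  χ-orthogonality {n} D lin y with dual D y in y∈D⊥
  ... | true = trans (sum-cong n term) (sym (ℤ.*-identityʳ (size D)))
    where
    term : ∀ x → 𝟙 (D x) * χ x y ≡ 𝟙 (D x)
    term x with D x in x∈D
    ... | false = refl
    ... | true = cong (λ b → + 1 * sgn b) (trans (⟨⟩-comm x y) (dual⇒orthogonal D y y∈D⊥ x x∈D))
  ... | false with ¬dual⇒∃ D y y∈D⊥
  ... | a , a∈D , ⟨y,a⟩≡1 = trans (sum-antiinvariant n _ a anti) (sym (ℤ.*-zeroʳ (size D)))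
    where
    χay≡-1 : χ a y ≡ - + 1
    χay≡-1 = cong sgn (trans (⟨⟩-comm a y) ⟨y,a⟩≡1)
    flip : ∀ d c → d * (c * - + 1) ≡ - (d * c)
    flip = solve-∀
    anti : ∀ x → 𝟙 (D (x ⊕ᵥ a)) * χ (x ⊕ᵥ a) y ≡ - (𝟙 (D x) * χ x y)
    anti x = begin
      𝟙 (D (x ⊕ᵥ a)) * χ (x ⊕ᵥ a) y   ≡⟨ cong₂ (λ b c → 𝟙 b * c) (linear-translate D lin a∈D x) (χ-⊕ᵥ x a y) ⟩
      𝟙 (D x) * (χ x y * χ a y)       ≡⟨ cong (λ c → 𝟙 (D x) * (χ x y * c)) χay≡-1 ⟩
      𝟙 (D x) * (χ x y * - + 1)       ≡⟨ flip (𝟙 (D x)) (χ x y) ⟩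
      - (𝟙 (D x) * χ x y)             ∎
      where open ≡-Reasoning

  transform : ∀ {n} → (Vec K n → ℤ) → Vec K n → ℤ
  transform {n} W x = sum n (λ t → W t * χ x t)

  sum-suc-* : ∀ n (f : Vec K (suc n) → ℤ) (α : K → ℤ) (g : Vec K n → ℤ) →
    (∀ k v → f (k ∷ v) ≡ α k * g v) → sum (suc n) f ≡ sumK α * sum n g
  sum-suc-* n f α g f≡αg =
    trans (sum-cong n (λ v → trans (sumK-cong (λ k → f≡αg k v)) (sumK-*ʳ α (g v))))
          (sum-*ˡ n (sumK α) g)

  transform-∷ : ∀ {n} (W : Vec K (suc n) → ℤ) (α β : K → ℤ) (U V : Vec K n → ℤ) →
    (∀ k v → W (k ∷ v) ≡ α k * U v + β k * V v) → ∀ y x →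
    transform W (y ∷ x) ≡
      sumK (λ k → α k * sgn (y ·K k)) * transform U x + sumK (λ k → β k * sgn (y ·K k)) * transform V x
  transform-∷ {n} W α β U V W-split y x = begin
    sum (suc n) (λ t → W t * χ (y ∷ x) t)
      ≡⟨ sum-cong (suc n) {f = λ t → W t * χ (y ∷ x) t} {g = λ t → f₁ t + f₂ t} (λ { (k ∷ v) → term k v }) ⟩
    sum (suc n) (λ t → f₁ t + f₂ t)
      ≡⟨ sum-+ (suc n) f₁ f₂ ⟩
    sum (suc n) f₁ + sum (suc n) f₂
      ≡⟨ cong₂ _+_ (sum-suc-* n f₁ (λ k → α k * sgn (y ·K k)) (λ v → U v * χ x v) (λ k v → refl))
                   (sum-suc-* n f₂ (λ k → β k * sgn (y ·K k)) (λ v → V v * χ x v) (λ k v → refl)) ⟩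
    sumK (λ k → α k * sgn (y ·K k)) * transform U x + sumK (λ k → β k * sgn (y ·K k)) * transform V x ∎
    where
    open ≡-Reasoning
    f₁ f₂ : Vec K (suc n) → ℤ
    f₁ (k ∷ v) = α k * sgn (y ·K k) * (U v * χ x v)
    f₂ (k ∷ v) = β k * sgn (y ·K k) * (V v * χ x v)
    distribute : ∀ a u b w s c → (a * u + b * w) * (s * c) ≡ a * s * (u * c) + b * s * (w * c)
    distribute = solve-∀
    term : ∀ k v → W (k ∷ v) * χ (y ∷ x) (k ∷ v) ≡ f₁ (k ∷ v) + f₂ (k ∷ v)
    term k v = begin
      W (k ∷ v) * χ (y ∷ x) (k ∷ v)
        ≡⟨ cong₂ _*_ (W-split k v) (sgn-xor (y ·K k) ⟨ x , v ⟩) ⟩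
      (α k * U v + β k * V v) * (sgn (y ·K k) * χ x v)
        ≡⟨ distribute (α k) (U v) (β k) (V v) (sgn (y ·K k)) (χ x v) ⟩
      f₁ (k ∷ v) + f₂ (k ∷ v) ∎

  ζ : ∀ {n} → Vec K n → ℤ
  ζ t = + zeros t

  zeroPairs : ∀ {n} → Vec K n → ℤ
  zeroPairs t = ζ t * (ζ t - + 1)

  zeroPairs-∷ : ∀ k {n} (v : Vec K n) →
    zeroPairs (k ∷ v) ≡ + 2 * 𝟙 (not (nonzero k)) * + zeros v + + 1 * zeroPairs v
  zeroPairs-∷ k v =
    trans (cong (λ z → z * (z - + 1)) (zeros-∷ k v)) (expand (𝟙 (not (nonzero k))) (+ zeros v) (idempotent k))
    where
    idempotent : ∀ k → 𝟙 (not (nonzero k)) * 𝟙 (not (nonzero k)) ≡ 𝟙 (not (nonzero k))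
    idempotent k0 = refl
    idempotent ka = refl
    idempotent kb = refl
    idempotent kc = refl
    expand : ∀ e z → e * e ≡ e → (e + z) * ((e + z) - + 1) ≡ + 2 * e * z + + 1 * (z * (z - + 1))
    expand e z e²≡e = begin
      (e + z) * ((e + z) - + 1)                         ≡⟨ open-up e z ⟩
      e * e - e + + 2 * e * z + + 1 * (z * (z - + 1))   ≡⟨ cong (λ s → s - e + + 2 * e * z + + 1 * (z * (z - + 1))) e²≡e ⟩
      e - e + + 2 * e * z + + 1 * (z * (z - + 1))       ≡⟨ cancel e z ⟩
      + 2 * e * z + + 1 * (z * (z - + 1))               ∎
      where
      open ≡-Reasoning
      open-up : ∀ e z → (e + z) * ((e + z) - + 1) ≡ e * e - e + + 2 * e * z + + 1 * (z * (z - + 1))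
      open-up = solve-∀
      cancel : ∀ e z → e - e + + 2 * e * z + + 1 * (z * (z - + 1)) ≡ + 2 * e * z + + 1 * (z * (z - + 1))
      cancel = solve-∀

  -- Tⱼ n w is the transform of 4 ^ j · zeros (zeros - 1) ⋯ (zeros - j + 1) at a word of
  -- weight w, namely j! · 4 ^ n · C(n - w, j - w), which vanishes for w > j.
  T₀ T₁ T₂ : ℕ → ℕ → ℤ
  T₀ n 0 = (+ 4) ^ n
  T₀ n (suc _) = + 0
  T₁ n 0 = + n * (+ 4) ^ n
  T₁ n 1 = (+ 4) ^ n
  T₁ n (suc (suc _)) = + 0
  T₂ n 0 = + n * (+ n - + 1) * (+ 4) ^ n
  T₂ n 1 = + 2 * (+ n - + 1) * (+ 4) ^ n
  T₂ n 2 = + 2 * (+ 4) ^ n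
  T₂ n (suc (suc (suc _))) = + 0

  transform-1 : ∀ {n} (x : Vec K n) → transform (λ _ → + 1) x ≡ T₀ n (wt x)
  transform-1 [] = refl
  transform-1 {suc n} (y ∷ x) =
    trans (transform-∷ (λ _ → + 1) (λ _ → + 1) (λ _ → + 0) (λ _ → + 1) (λ _ → + 1) (λ _ _ → refl) y x)
          (head y)
    where
    head : ∀ y → sumK (λ k → + 1 * sgn (y ·K k)) * transform (λ _ → + 1) x + + 0
                 ≡ T₀ (suc n) (wt (y ∷ x))
    head k0 rewrite transform-1 x = recurrence (wt x)
      where
      recurrence : ∀ w → + 4 * T₀ n w + + 0 ≡ T₀ (suc n) w
      recurrence zero = ℤ.+-identityʳ _
      recurrence (suc w) = refl
    head ka = refl
    head kb = refl
    head kc = refl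

  transform-zeros : ∀ {n} (x : Vec K n) → + 4 * transform ζ x ≡ T₁ n (wt x)
  transform-zeros [] = refl
  transform-zeros {suc n} (y ∷ x) = trans (cong (+ 4 *_) (transform-∷ ζ (λ k → 𝟙 (not (nonzero k))) (λ _ → + 1) (λ _ → + 1) ζ ζ-∷ y x)) (head y)
    where
    ζ-∷ : ∀ k (v : Vec K n) → ζ (k ∷ v) ≡ 𝟙 (not (nonzero k)) * + 1 + + 1 * ζ v
    ζ-∷ k v = trans (zeros-∷ k v)
      (cong₂ _+_ (sym (ℤ.*-identityʳ (𝟙 (not (nonzero k))))) (sym (ℤ.*-identityˡ (ζ v))))
    nonzeroHead : + 4 * (+ 1 * transform (λ _ → + 1) x + + 0) ≡ T₁ (suc n) (suc (wt x))
    nonzeroHead rewrite transform-1 x = recurrence (wt x)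
      where
      recurrence : ∀ w → + 4 * (+ 1 * T₀ n w + + 0) ≡ T₁ (suc n) (suc w)
      recurrence 0 = cong (+ 4 *_) (trans (ℤ.+-identityʳ _) (ℤ.*-identityˡ _))
      recurrence (suc w) = refl
    head : ∀ y → + 4 * (sumK (λ k → 𝟙 (not (nonzero k)) * sgn (y ·K k)) * transform (λ _ → + 1) x
                        + sumK (λ k → + 1 * sgn (y ·K k)) * transform ζ x)
                 ≡ T₁ (suc n) (wt (y ∷ x))
    head k0 = begin
      + 4 * (+ 1 * transform (λ _ → + 1) x + + 4 * transform ζ x)
        ≡⟨ regroup (transform (λ _ → + 1) x) (transform ζ x) ⟩
      + 4 * transform (λ _ → + 1) x + + 4 * (+ 4 * transform ζ x)
        ≡⟨ cong₂ (λ a b → + 4 * a + + 4 * b) (transform-1 x) (transform-zeros x) ⟩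
      + 4 * T₀ n (wt x) + + 4 * T₁ n (wt x)
        ≡⟨ recurrence (wt x) ⟩
      T₁ (suc n) (wt x) ∎
      where
      open ≡-Reasoning
      regroup : ∀ a b → + 4 * (+ 1 * a + + 4 * b) ≡ + 4 * a + + 4 * (+ 4 * b)
      regroup = solve-∀
      recurrence : ∀ w → + 4 * T₀ n w + + 4 * T₁ n w ≡ T₁ (suc n) w
      recurrence 0 = shift (+ n) ((+ 4) ^ n)
        where
        shift : ∀ m p → + 4 * p + + 4 * (m * p) ≡ (+ 1 + m) * (+ 4 * p)
        shift = solve-∀
      recurrence 1 = ℤ.+-identityˡ _
      recurrence (suc (suc w)) = refl
    head ka = nonzeroHead
    head kb = nonzeroHead
    head kc = nonzeroHead

  transform-zeroPairs : ∀ {n} (x : Vec K n) → + 16 * transform zeroPairs x ≡ T₂ n (wt x)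
  transform-zeroPairs [] = refl
  transform-zeroPairs {suc n} (y ∷ x) =
    trans (cong (+ 16 *_) (transform-∷ zeroPairs (λ k → + 2 * 𝟙 (not (nonzero k))) (λ _ → + 1)
                                       ζ zeroPairs (λ k v → zeroPairs-∷ k v) y x))
          (head y)
    where
    nonzeroHead : + 16 * (+ 2 * transform ζ x + + 0) ≡ T₂ (suc n) (suc (wt x))
    nonzeroHead = begin
      + 16 * (+ 2 * transform ζ x + + 0)   ≡⟨ regroup (transform ζ x) ⟩
      + 8 * (+ 4 * transform ζ x)          ≡⟨ cong (+ 8 *_) (transform-zeros x) ⟩
      + 8 * T₁ n (wt x)                    ≡⟨ recurrence (wt x) ⟩
      T₂ (suc n) (suc (wt x))              ∎
      where
      open ≡-Reasoning
      regroup : ∀ a → + 16 * (+ 2 * a + + 0) ≡ + 8 * (+ 4 * a)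
      regroup = solve-∀
      recurrence : ∀ w → + 8 * T₁ n w ≡ T₂ (suc n) (suc w)
      recurrence 0 = shift (+ n) ((+ 4) ^ n)
        where
        shift : ∀ m p → + 8 * (m * p) ≡ + 2 * ((+ 1 + m) - + 1) * (+ 4 * p)
        shift = solve-∀
      recurrence 1 = double ((+ 4) ^ n)
        where
        double : ∀ p → + 8 * p ≡ + 2 * (+ 4 * p)
        double = solve-∀
      recurrence (suc (suc w)) = refl
    head : ∀ y → + 16 * (sumK (λ k → + 2 * 𝟙 (not (nonzero k)) * sgn (y ·K k)) * transform ζ x
                         + sumK (λ k → + 1 * sgn (y ·K k)) * transform zeroPairs x)
                 ≡ T₂ (suc n) (wt (y ∷ x))
    head k0 = begin
      + 16 * (+ 2 * transform ζ x + + 4 * transform zeroPairs x)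
        ≡⟨ regroup (transform ζ x) (transform zeroPairs x) ⟩
      + 8 * (+ 4 * transform ζ x) + + 4 * (+ 16 * transform zeroPairs x)
        ≡⟨ cong₂ (λ a b → + 8 * a + + 4 * b) (transform-zeros x) (transform-zeroPairs x) ⟩
      + 8 * T₁ n (wt x) + + 4 * T₂ n (wt x)
        ≡⟨ recurrence (wt x) ⟩
      T₂ (suc n) (wt x) ∎
      where
      open ≡-Reasoning
      regroup : ∀ a b → + 16 * (+ 2 * a + + 4 * b) ≡ + 8 * (+ 4 * a) + + 4 * (+ 16 * b)
      regroup = solve-∀
      recurrence : ∀ w → + 8 * T₁ n w + + 4 * T₂ n w ≡ T₂ (suc n) w
      recurrence 0 = shift (+ n) ((+ 4) ^ n)
        where
        shift : ∀ m p → + 8 * (m * p) + + 4 * (m * (m - + 1) * p) ≡ (+ 1 + m) * ((+ 1 + m) - + 1) * (+ 4 * p)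
        shift = solve-∀
      recurrence 1 = shift (+ n) ((+ 4) ^ n)
        where
        shift : ∀ m p → + 8 * p + + 4 * (+ 2 * (m - + 1) * p) ≡ + 2 * ((+ 1 + m) - + 1) * (+ 4 * p)
        shift = solve-∀
      recurrence 2 = double ((+ 4) ^ n)
        where
        double : ∀ p → + 8 * + 0 + + 4 * (+ 2 * p) ≡ + 2 * (+ 4 * p)
        double = solve-∀
      recurrence (suc (suc (suc w))) = refl
    head ka = nonzeroHead
    head kb = nonzeroHead
    head kc = nonzeroHead

  transform-sgnWt : ∀ {n} (x : Vec K n) → transform sgnWt x ≡ sgnWt x * (- + 2) ^ n
  transform-sgnWt [] = refl
  transform-sgnWt {suc n} (y ∷ x) =
    trans (transform-∷ sgnWt (λ k → sgn (nonzero k)) (λ _ → + 0) sgnWt sgnWt sgnWt-∷ y x) (head y)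
    where
    sgnWt-∷ : ∀ k (v : Vec K n) → sgnWt (k ∷ v) ≡ sgn (nonzero k) * sgnWt v + + 0 * sgnWt v
    sgnWt-∷ k v = trans (sgn-xor (nonzero k) (oddWt v)) (sym (ℤ.+-identityʳ _))
    nonzeroHead : + 2 * transform sgnWt x + + 0 ≡ - sgnWt x * (- + 2 * (- + 2) ^ n)
    nonzeroHead = begin
      + 2 * transform sgnWt x + + 0         ≡⟨ cong (λ t → + 2 * t + + 0) (transform-sgnWt x) ⟩
      + 2 * (sgnWt x * (- + 2) ^ n) + + 0   ≡⟨ flip (sgnWt x) ((- + 2) ^ n) ⟩
      - sgnWt x * (- + 2 * (- + 2) ^ n)     ∎
      where
      open ≡-Reasoning
      flip : ∀ s p → + 2 * (s * p) + + 0 ≡ - s * (- + 2 * p)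
      flip = solve-∀
    head : ∀ y → sumK (λ k → sgn (nonzero k) * sgn (y ·K k)) * transform sgnWt x + + 0
                 ≡ sgnWt (y ∷ x) * (- + 2) ^ suc n
    head k0 = begin
      - + 2 * transform sgnWt x + + 0       ≡⟨ cong (λ t → - + 2 * t + + 0) (transform-sgnWt x) ⟩
      - + 2 * (sgnWt x * (- + 2) ^ n) + + 0 ≡⟨ swap (sgnWt x) ((- + 2) ^ n) ⟩
      sgnWt x * (- + 2 * (- + 2) ^ n)       ∎
      where
      open ≡-Reasoning
      swap : ∀ s p → - + 2 * (s * p) + + 0 ≡ s * (- + 2 * p)
      swap = solve-∀
    head ka = trans nonzeroHead (cong (_* (- + 2) ^ suc n) (sym (sgn-not (oddWt x))))
    head kb = trans nonzeroHead (cong (_* (- + 2) ^ suc n) (sym (sgn-not (oddWt x))))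
    head kc = trans nonzeroHead (cong (_* (- + 2) ^ suc n) (sym (sgn-not (oddWt x))))

  ≡ᵇ-refl : ∀ m → (m ℕ.≡ᵇ m) ≡ true
  ≡ᵇ-refl m = Equivalence.to T-≡ (ℕ.≡⇒≡ᵇ m m refl)

  2+m≢ᵇm : ∀ m → (2 ℕ.+ m ℕ.≡ᵇ m) ≡ false
  2+m≢ᵇm zero = refl
  2+m≢ᵇm (suc m) = 2+m≢ᵇm m

  zeros≡2*𝟙[wt≡length∸2] : ∀ {n} → 1 ℕ.≤ n → (y : Vec K n) → zeros y ≡ 0 ⊎ zeros y ≡ 2 →
    + zeros y ≡ + 2 * 𝟙 (wt y ℕ.≡ᵇ (n ∸ 2))
  zeros≡2*𝟙[wt≡length∸2] {n} 1≤n y z≡0⊎2 rewrite wt≡length∸zeros y with z≡0⊎2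
  ... | inj₁ z≡0 rewrite z≡0 = cong (λ b → + 2 * 𝟙 b) (sym (n≢ᵇn∸2 n 1≤n))
    where
    n≢ᵇn∸2 : ∀ n → 1 ℕ.≤ n → (n ℕ.≡ᵇ (n ∸ 2)) ≡ false
    n≢ᵇn∸2 (suc zero) _ = refl
    n≢ᵇn∸2 (suc (suc m)) _ = 2+m≢ᵇm m
  ... | inj₂ z≡2 rewrite z≡2 = cong (λ b → + 2 * 𝟙 b) (sym (≡ᵇ-refl (n ∸ 2)))

  excessZeros : ℕ → ℤ
  excessZeros z = + z * (+ z - + 2)

  excessZeros-2+ : ∀ m → excessZeros (2 ℕ.+ m) ≡ + ((2 ℕ.+ m) ℕ.* m)
  excessZeros-2+ m = trans (shift (+ m)) (sym (ℤ.pos-* (2 ℕ.+ m) m))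
    where
    shift : ∀ a → (+ 2 + a) * ((+ 2 + a) - + 2) ≡ (+ 2 + a) * a
    shift = solve-∀

  even⇒0≤excessZeros : ∀ z → evenℕ z ≡ true → + 0 ≤ excessZeros z
  even⇒0≤excessZeros zero _ = +≤+ z≤n
  even⇒0≤excessZeros (suc (suc m)) _ = subst (+ 0 ≤_) (sym (excessZeros-2+ m)) (+≤+ z≤n)

  excessZeros≡0⇒≤2 : ∀ z → excessZeros z ≡ + 0 → z ℕ.≤ 2
  excessZeros≡0⇒≤2 0 _ = z≤n
  excessZeros≡0⇒≤2 2 _ = s≤s (s≤s z≤n)
  excessZeros≡0⇒≤2 (suc (suc (suc m))) e with trans (sym (excessZeros-2+ (suc m))) e
  ... | ()

  even-≤2⇒0⊎2 : ∀ z → evenℕ z ≡ true → z ℕ.≤ 2 → z ≡ 0 ⊎ z ≡ 2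
  even-≤2⇒0⊎2 0 _ _ = inj₁ refl
  even-≤2⇒0⊎2 2 _ _ = inj₂ refl
  even-≤2⇒0⊎2 (suc (suc (suc _))) _ (s≤s (s≤s ()))

  even-≤2⇒excessZeros≡0 : ∀ z → evenℕ z ≡ true → z ℕ.≤ 2 → excessZeros z ≡ + 0
  even-≤2⇒excessZeros≡0 z even z≤2 with even-≤2⇒0⊎2 z even z≤2
  ... | inj₁ refl = refl
  ... | inj₂ refl = refl

  module SelfDualCode {n} (C : Subset n) (lin : IsLinearCode C) (sd : IsSelfDual C) where

    orthogonal : ∀ x y → C x ≡ true → C y ≡ true → ⟨ x , y ⟩ ≡ false
    orthogonal x y x∈C = dual⇒orthogonal C x (trans (sym (sd x)) x∈C) y

    size*size : size C * size C ≡ (+ 4) ^ n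
    size*size = begin
      size C * size C                                 ≡⟨ sum-*ˡ n (size C) (λ y → 𝟙 (C y)) ⟨
      sum n (λ y → size C * 𝟙 (C y))                  ≡⟨ sum-cong n (λ y → cong (λ b → size C * 𝟙 b) (sd y)) ⟩
      sum n (λ y → size C * 𝟙 (dual C y))             ≡⟨ sum-cong n (λ y → χ-orthogonality C lin y) ⟨
      sum n (λ y → sum n (λ x → 𝟙 (C x) * χ x y))     ≡⟨ sum-swap n n (λ y x → 𝟙 (C x) * χ x y) ⟩
      sum n (λ x → sum n (λ y → 𝟙 (C x) * χ x y))     ≡⟨ sum-cong n (λ x → sum-*ˡ n (𝟙 (C x)) (χ x)) ⟩
      sum n (λ x → 𝟙 (C x) * sum n (χ x))             ≡⟨ sum-cong n only-zero-word ⟩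
      sum n (λ x → 𝟙 (wt x ℕ.≡ᵇ 0) * (+ 4) ^ n)       ≡⟨ sum-δ₀ n ((+ 4) ^ n) ⟩
      (+ 4) ^ n                                       ∎
      where
      open ≡-Reasoning
      only-zero-word : ∀ x → 𝟙 (C x) * sum n (χ x) ≡ 𝟙 (wt x ℕ.≡ᵇ 0) * (+ 4) ^ n
      only-zero-word x rewrite trans (sum-cong n (λ t → sym (ℤ.*-identityˡ (χ x t)))) (transform-1 x)
        with wt x in wt≡
      ... | zero rewrite wt≡0⇒≡zeroVec x wt≡ | proj₁ lin = refl
      ... | suc _ = ℤ.*-zeroʳ (𝟙 (C x))

    size≡2^n : size C ≡ (+ 2) ^ n
    size≡2^n = i*i≡j*j⇒i≡j (sum-nonneg n _ (λ x → 0≤𝟙 (C x))) (ℤ.<⇒≤ (0<2^n n))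
                            (trans size*size (4^n≡2^n*2^n n))

    shadow-indicator-even : isEven C ≡ true → ∀ y →
      size C * 𝟙 (C y) ≡ sum n (λ x → 𝟙 (C x) * sgnWt x * χ x y)
    shadow-indicator-even even? y = begin
      size C * 𝟙 (C y)                         ≡⟨ cong (λ b → size C * 𝟙 b) (sd y) ⟩
      size C * 𝟙 (dual C y)                    ≡⟨ χ-orthogonality C lin y ⟨
      sum n (λ x → 𝟙 (C x) * χ x y)            ≡⟨ sum-cong n insert-sign ⟩
      sum n (λ x → 𝟙 (C x) * sgnWt x * χ x y)  ∎
      where
      open ≡-Reasoning
      insert-sign : ∀ x → 𝟙 (C x) * χ x y ≡ 𝟙 (C x) * sgnWt x * χ x y
      insert-sign x with C x in x∈C | allL-true _ even? (∈-allVecs x)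
      ... | false | _ = refl
      ... | true | x-even rewrite sgnWt-even x x-even = cong (_* χ x y) (ℤ.*-identityʳ (+ 1))

    C₀ : Subset n
    C₀ = evenSubcode C

    evenSubcode-linear : IsLinearCode C₀
    evenSubcode-linear = cong₂ _∧_ (proj₁ lin) (cong evenℕ (wt-zeroVec n)) , closed
      where
      closed : ∀ x y → C₀ x ≡ true → C₀ y ≡ true → C₀ (x ⊕ᵥ y) ≡ true
      closed x y x∈C₀ y∈C₀ = cong₂ _∧_ (proj₂ lin x y x∈C y∈C) (begin
        evenℕ (wt (x ⊕ᵥ y))                           ≡⟨ evenℕ-wt (x ⊕ᵥ y) ⟩
        not (oddWt (x ⊕ᵥ y))                          ≡⟨ cong not (oddWt-⊕ᵥ x y) ⟩
        not ((oddWt x xor oddWt y) xor ⟨ x , y ⟩)     ≡⟨ cong not (cong₂ _xor_ (cong₂ _xor_ x-even y-even) (orthogonal x y x∈C y∈C)) ⟩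
        true                                          ∎)
        where
        open ≡-Reasoning
        x∈C : C x ≡ true
        x∈C = ∧-conicalˡ (C x) _ x∈C₀
        y∈C : C y ≡ true
        y∈C = ∧-conicalˡ (C y) _ y∈C₀
        x-even : oddWt x ≡ false
        x-even = evenℕ-wt⇒¬oddWt x (∧-conicalʳ (C x) _ x∈C₀)
        y-even : oddWt y ≡ false
        y-even = evenℕ-wt⇒¬oddWt y (∧-conicalʳ (C y) _ y∈C₀)

    C⊆dual-C₀ : ∀ y → C y ≡ true → dual C₀ y ≡ true
    C⊆dual-C₀ y y∈C = orthogonal⇒dual C₀ y (λ x x∈C₀ → orthogonal y x y∈C (∧-conicalˡ (C x) _ x∈C₀))

    2*𝟙-C₀ : ∀ x → + 2 * 𝟙 (C₀ x) ≡ 𝟙 (C x) * (+ 1 + sgnWt x)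
    2*𝟙-C₀ x = trans (cong (λ e → + 2 * 𝟙 (C x ∧ e)) (evenℕ-wt x)) (cases (C x) (oddWt x))
      where
      cases : ∀ c o → + 2 * 𝟙 (c ∧ not o) ≡ 𝟙 c * (+ 1 + sgn o)
      cases true true = refl
      cases true false = refl
      cases false true = refl
      cases false false = refl

    module _ {a} (a∈C : C a ≡ true) (a-odd : oddWt a ≡ true) where

      sum-sgnWt≡0 : sum n (λ x → 𝟙 (C x) * sgnWt x) ≡ + 0
      sum-sgnWt≡0 = sum-antiinvariant n _ a anti
        where
        anti : ∀ x → 𝟙 (C (x ⊕ᵥ a)) * sgnWt (x ⊕ᵥ a) ≡ - (𝟙 (C x) * sgnWt x)
        anti x rewrite linear-translate C lin a∈C x | sgnWt-⊕ᵥ x a | a-odd with C x in x∈C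
        ... | false = refl
        ... | true rewrite orthogonal x a x∈C a∈C = flip (sgnWt x)
          where
          flip : ∀ s → + 1 * (s * - + 1 * + 1) ≡ - (+ 1 * s)
          flip = solve-∀

      2*size-C₀ : + 2 * size C₀ ≡ size C
      2*size-C₀ = begin
        + 2 * size C₀                                   ≡⟨ sum-*ˡ n (+ 2) _ ⟨
        sum n (λ x → + 2 * 𝟙 (C₀ x))                    ≡⟨ sum-cong n (λ x → trans (2*𝟙-C₀ x) (expand (𝟙 (C x)) (sgnWt x))) ⟩
        sum n (λ x → 𝟙 (C x) + 𝟙 (C x) * sgnWt x)       ≡⟨ sum-+ n _ _ ⟩
        size C + sum n (λ x → 𝟙 (C x) * sgnWt x)        ≡⟨ cong (_+_ (size C)) sum-sgnWt≡0 ⟩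
        size C + + 0                                    ≡⟨ ℤ.+-identityʳ _ ⟩
        size C                                          ∎
        where
        open ≡-Reasoning
        expand : ∀ c s → c * (+ 1 + s) ≡ c + c * s
        expand = solve-∀

      shadow-indicator-odd : ∀ y →
        size C * 𝟙 (dual C₀ y ∧ not (C y)) ≡ sum n (λ x → 𝟙 (C x) * sgnWt x * χ x y)
      shadow-indicator-odd y = begin
        size C * 𝟙 (dual C₀ y ∧ not (C y))
          ≡⟨ cong (size C *_) (𝟙-∧-not (dual C₀ y) (C y) (C⊆dual-C₀ y)) ⟩
        size C * (𝟙 (dual C₀ y) - 𝟙 (C y))
          ≡⟨ distrib (size C) (𝟙 (dual C₀ y)) (𝟙 (C y)) ⟩
        size C * 𝟙 (dual C₀ y) - size C * 𝟙 (C y)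
          ≡⟨ cong₂ (λ s b → s * 𝟙 (dual C₀ y) - size C * 𝟙 b) (sym 2*size-C₀) (sd y) ⟩
        + 2 * size C₀ * 𝟙 (dual C₀ y) - size C * 𝟙 (dual C y)
          ≡⟨ cong₂ _-_ (trans (ℤ.*-assoc (+ 2) (size C₀) (𝟙 (dual C₀ y)))
                              (cong (+ 2 *_) (sym (χ-orthogonality C₀ evenSubcode-linear y))))
                       (sym (χ-orthogonality C lin y)) ⟩
        + 2 * sum n (λ x → 𝟙 (C₀ x) * χ x y) - sum n (λ x → 𝟙 (C x) * χ x y)
          ≡⟨ cong (_- sum n (λ x → 𝟙 (C x) * χ x y)) (sum-*ˡ n (+ 2) _) ⟨
        sum n (λ x → + 2 * (𝟙 (C₀ x) * χ x y)) - sum n (λ x → 𝟙 (C x) * χ x y)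
          ≡⟨ sum-minus n _ _ ⟨
        sum n (λ x → + 2 * (𝟙 (C₀ x) * χ x y) - 𝟙 (C x) * χ x y)
          ≡⟨ sum-cong n (λ x → trans (regroup (𝟙 (C₀ x)) (𝟙 (C x)) (χ x y))
                                     (cong (λ t → t * χ x y - 𝟙 (C x) * χ x y) (2*𝟙-C₀ x))) ⟩
        sum n (λ x → 𝟙 (C x) * (+ 1 + sgnWt x) * χ x y - 𝟙 (C x) * χ x y)
          ≡⟨ sum-cong n (λ x → cancel (𝟙 (C x)) (sgnWt x) (χ x y)) ⟩
        sum n (λ x → 𝟙 (C x) * sgnWt x * χ x y) ∎
        where
        open ≡-Reasoning
        distrib : ∀ s d c → s * (d - c) ≡ s * d - s * c
        distrib = solve-∀
        regroup : ∀ e c t → + 2 * (e * t) - c * t ≡ + 2 * e * t - c * t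
        regroup = solve-∀
        cancel : ∀ c s t → c * (+ 1 + s) * t - c * t ≡ c * s * t
        cancel = solve-∀

    shadow-indicator : ∀ y → size C * 𝟙 (shadow C y) ≡ sum n (λ x → 𝟙 (C x) * sgnWt x * χ x y)
    shadow-indicator y with isEven C in even?
    ... | true = shadow-indicator-even even? y
    ... | false with allL-false _ (allVecs n) even?
    ... | a , a-test with C a in a∈C | evenℕ (wt a) in a-even?
    ... | true | false = shadow-indicator-odd a∈C (trans (oddWt≡not-evenℕ-wt a) (cong not a-even?)) y

    sum-shadow : ∀ (W : Vec K n → ℤ) →
      size C * sum n (λ y → 𝟙 (shadow C y) * W y) ≡ sum n (λ x → 𝟙 (C x) * sgnWt x * transform W x)
    sum-shadow W = begin
      size C * sum n (λ y → 𝟙 (shadow C y) * W y)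
        ≡⟨ sum-*ˡ n (size C) _ ⟨
      sum n (λ y → size C * (𝟙 (shadow C y) * W y))
        ≡⟨ sum-cong n (λ y → trans (sym (ℤ.*-assoc (size C) _ (W y))) (cong (_* W y) (shadow-indicator y))) ⟩
      sum n (λ y → sum n (λ x → 𝟙 (C x) * sgnWt x * χ x y) * W y)
        ≡⟨ sum-cong n (λ y → sum-*ʳ n (λ x → 𝟙 (C x) * sgnWt x * χ x y) (W y)) ⟨
      sum n (λ y → sum n (λ x → 𝟙 (C x) * sgnWt x * χ x y * W y))
        ≡⟨ sum-swap n n (λ y x → 𝟙 (C x) * sgnWt x * χ x y * W y) ⟩
      sum n (λ x → sum n (λ y → 𝟙 (C x) * sgnWt x * χ x y * W y))
        ≡⟨ sum-cong n (λ x → trans (sum-cong n (λ y → reorder (𝟙 (C x) * sgnWt x) (χ x y) (W y)))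
                                   (sum-*ˡ n (𝟙 (C x) * sgnWt x) (λ t → W t * χ x t))) ⟩
      sum n (λ x → 𝟙 (C x) * sgnWt x * transform W x) ∎
      where
      open ≡-Reasoning
      reorder : ∀ a c w → a * c * w ≡ a * (w * c)
      reorder = solve-∀

    cancel-size : ∀ {i j} → size C * i ≡ size C * j → i ≡ j
    cancel-size {i} {j} e = 2^n*-cancelˡ-≡ n (subst (λ s → s * i ≡ s * j) size≡2^n e)

    sum-shadow-sgnWt : sum n (λ y → 𝟙 (shadow C y) * sgnWt y) ≡ (- + 2) ^ n
    sum-shadow-sgnWt = cancel-size (begin
      size C * sum n (λ y → 𝟙 (shadow C y) * sgnWt y)      ≡⟨ sum-shadow sgnWt ⟩
      sum n (λ x → 𝟙 (C x) * sgnWt x * transform sgnWt x)  ≡⟨ sum-cong n sign² ⟩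
      sum n (λ x → 𝟙 (C x) * (- + 2) ^ n)                  ≡⟨ sum-*ʳ n _ _ ⟩
      size C * (- + 2) ^ n                                 ∎)
      where
      open ≡-Reasoning
      sign² : ∀ x → 𝟙 (C x) * sgnWt x * transform sgnWt x ≡ 𝟙 (C x) * (- + 2) ^ n
      sign² x = begin
        𝟙 (C x) * sgnWt x * transform sgnWt x         ≡⟨ cong (𝟙 (C x) * sgnWt x *_) (transform-sgnWt x) ⟩
        𝟙 (C x) * sgnWt x * (sgnWt x * (- + 2) ^ n)   ≡⟨ reorder (𝟙 (C x)) (sgnWt x) ((- + 2) ^ n) ⟩
        𝟙 (C x) * (sgnWt x * sgnWt x) * (- + 2) ^ n   ≡⟨ cong (λ s → 𝟙 (C x) * s * (- + 2) ^ n) (sgn*sgn≡1 (oddWt x)) ⟩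
        𝟙 (C x) * + 1 * (- + 2) ^ n                   ≡⟨ cong (_* (- + 2) ^ n) (ℤ.*-identityʳ (𝟙 (C x))) ⟩
        𝟙 (C x) * (- + 2) ^ n                         ∎
        where
        reorder : ∀ c s p → c * s * (s * p) ≡ c * (s * s) * p
        reorder = solve-∀

    module NoWeightOne (no-wt-1 : ∀ x → C x ≡ true → wt x ≢ 1) where

      A₂ : ℕ
      A₂ = numOfWeight C 2

      sum-code-weight≤2 : (R : ℕ → ℤ) → (∀ w → R (3 ℕ.+ w) ≡ + 0) →
        sum n (λ x → 𝟙 (C x) * sgnWt x * R (wt x)) ≡ R 0 + + A₂ * R 2
      sum-code-weight≤2 R R≥3≡0 = begin
        sum n (λ x → 𝟙 (C x) * sgnWt x * R (wt x))
          ≡⟨ sum-cong n split ⟩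
        sum n (λ x → 𝟙 (wt x ℕ.≡ᵇ 0) * R 0 + 𝟙 (C x ∧ (wt x ℕ.≡ᵇ 2)) * R 2)
          ≡⟨ sum-+ n _ _ ⟩
        sum n (λ x → 𝟙 (wt x ℕ.≡ᵇ 0) * R 0) + sum n (λ x → 𝟙 (C x ∧ (wt x ℕ.≡ᵇ 2)) * R 2)
          ≡⟨ cong₂ _+_ (sum-δ₀ n (R 0)) (sum-*ʳ n _ (R 2)) ⟩
        R 0 + sum n (λ x → 𝟙 (C x ∧ (wt x ℕ.≡ᵇ 2))) * R 2
          ≡⟨ cong (λ a → R 0 + a * R 2) (count-allVecs n _) ⟨
        R 0 + + A₂ * R 2 ∎
        where
        open ≡-Reasoning
        split : ∀ x → 𝟙 (C x) * sgnWt x * R (wt x) ≡ 𝟙 (wt x ℕ.≡ᵇ 0) * R 0 + 𝟙 (C x ∧ (wt x ℕ.≡ᵇ 2)) * R 2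
        split x with wt x in wt≡
        ... | 0 rewrite sgnWt-even x (cong evenℕ wt≡) | trans (cong C (wt≡0⇒≡zeroVec x wt≡)) (proj₁ lin) =
          drop-zero (R 0)
          where
          drop-zero : ∀ r → + 1 * + 1 * r ≡ + 1 * r + + 0
          drop-zero = solve-∀
        ... | 1 with C x in x∈C
        ...   | false = refl
        ...   | true = ⊥-elim (no-wt-1 x x∈C wt≡)
        split x | 2 rewrite sgnWt-even x (cong evenℕ wt≡) with C x
        ...   | false = refl
        ...   | true = drop-zero (R 2)
          where
          drop-zero : ∀ r → + 1 * + 1 * r ≡ + 0 + + 1 * r
          drop-zero = solve-∀
        split x | suc (suc (suc w)) rewrite R≥3≡0 w with C x
        ...   | false = refl
        ...   | true = ℤ.*-zeroʳ (+ 1 * sgnWt x)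

      shadow-moment : (W : Vec K n → ℤ) (c : ℤ) (R : ℕ → ℤ) → (∀ w → R (3 ℕ.+ w) ≡ + 0) →
        (∀ x → c * transform W x ≡ R (wt x)) →
        (+ 2) ^ n * (c * sum n (λ y → 𝟙 (shadow C y) * W y)) ≡ R 0 + + A₂ * R 2
      shadow-moment W c R R≥3≡0 cW≡R = begin
        (+ 2) ^ n * (c * sum n (λ y → 𝟙 (shadow C y) * W y))
          ≡⟨ cong (λ s → s * (c * sum n (λ y → 𝟙 (shadow C y) * W y))) size≡2^n ⟨
        size C * (c * sum n (λ y → 𝟙 (shadow C y) * W y))
          ≡⟨ swap (size C) c _ ⟩
        c * (size C * sum n (λ y → 𝟙 (shadow C y) * W y))
          ≡⟨ cong (c *_) (sum-shadow W) ⟩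
        c * sum n (λ x → 𝟙 (C x) * sgnWt x * transform W x)
          ≡⟨ sum-*ˡ n c _ ⟨
        sum n (λ x → c * (𝟙 (C x) * sgnWt x * transform W x))
          ≡⟨ sum-cong n (λ x → trans (swap c (𝟙 (C x) * sgnWt x) (transform W x))
                                     (cong (𝟙 (C x) * sgnWt x *_) (cW≡R x))) ⟩
        sum n (λ x → 𝟙 (C x) * sgnWt x * R (wt x))
          ≡⟨ sum-code-weight≤2 R R≥3≡0 ⟩
        R 0 + + A₂ * R 2 ∎
        where
        open ≡-Reasoning
        swap : ∀ a b c → a * (b * c) ≡ b * (a * c)
        swap = solve-∀

      size-shadow : size (shadow C) ≡ (+ 2) ^ n
      size-shadow = 2^n*-cancelˡ-≡ n (begin
        (+ 2) ^ n * size (shadow C)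
          ≡⟨ cong ((+ 2) ^ n *_) (trans (sum-cong n (λ y → sym (ℤ.*-identityʳ (𝟙 (shadow C y)))))
                                         (sym (ℤ.*-identityˡ _))) ⟩
        (+ 2) ^ n * (+ 1 * sum n (λ y → 𝟙 (shadow C y) * + 1))
          ≡⟨ shadow-moment (λ _ → + 1) (+ 1) (T₀ n) (λ _ → refl)
                           (λ x → trans (ℤ.*-identityˡ _) (transform-1 x)) ⟩
        (+ 4) ^ n + + A₂ * + 0
          ≡⟨ trans (cong (_+_ ((+ 4) ^ n)) (ℤ.*-zeroʳ (+ A₂))) (ℤ.+-identityʳ _) ⟩
        (+ 4) ^ n
          ≡⟨ 4^n≡2^n*2^n n ⟩
        (+ 2) ^ n * (+ 2) ^ n ∎)
        where open ≡-Reasoning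

      4*sum-zeros : + 4 * sum n (λ y → 𝟙 (shadow C y) * + zeros y) ≡ + n * (+ 2) ^ n
      4*sum-zeros = 2^n*-cancelˡ-≡ n (begin
        (+ 2) ^ n * (+ 4 * sum n (λ y → 𝟙 (shadow C y) * + zeros y))
          ≡⟨ shadow-moment ζ (+ 4) (T₁ n) (λ _ → refl) transform-zeros ⟩
        + n * (+ 4) ^ n + + A₂ * + 0
          ≡⟨ cong (λ q → + n * q + + A₂ * + 0) (4^n≡2^n*2^n n) ⟩
        + n * ((+ 2) ^ n * (+ 2) ^ n) + + A₂ * + 0
          ≡⟨ regroup (+ n) ((+ 2) ^ n) (+ A₂) ⟩
        (+ 2) ^ n * (+ n * (+ 2) ^ n) ∎)
        where
        open ≡-Reasoning
        regroup : ∀ m p a → m * (p * p) + a * + 0 ≡ p * (m * p)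
        regroup = solve-∀

      16*sum-zeroPairs : + 16 * sum n (λ y → 𝟙 (shadow C y) * zeroPairs y)
                         ≡ (+ 2) ^ n * (+ n * (+ n - + 1) + + 2 * + A₂)
      16*sum-zeroPairs = 2^n*-cancelˡ-≡ n (begin
        (+ 2) ^ n * (+ 16 * sum n (λ y → 𝟙 (shadow C y) * zeroPairs y))
          ≡⟨ shadow-moment zeroPairs (+ 16) (T₂ n) (λ _ → refl) transform-zeroPairs ⟩
        + n * (+ n - + 1) * (+ 4) ^ n + + A₂ * (+ 2 * (+ 4) ^ n)
          ≡⟨ cong (λ q → + n * (+ n - + 1) * q + + A₂ * (+ 2 * q)) (4^n≡2^n*2^n n) ⟩
        + n * (+ n - + 1) * ((+ 2) ^ n * (+ 2) ^ n) + + A₂ * (+ 2 * ((+ 2) ^ n * (+ 2) ^ n))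
          ≡⟨ regroup (+ n) ((+ 2) ^ n) (+ A₂) ⟩
        (+ 2) ^ n * ((+ 2) ^ n * (+ n * (+ n - + 1) + + 2 * + A₂)) ∎)
        where
        open ≡-Reasoning
        regroup : ∀ m p a → m * (m - + 1) * (p * p) + a * (+ 2 * (p * p)) ≡ p * (p * (m * (m - + 1) + + 2 * a))
        regroup = solve-∀

      shadow⇒even-zeros : ∀ y → shadow C y ≡ true → evenℕ (zeros y) ≡ true
      shadow⇒even-zeros y y∈S =
        even (subst (λ b → 𝟙 b * (+ 1 - sgnℕ (zeros y)) ≡ + 0) y∈S (sum-nonneg≡0⇒≡0 n f f≥0 Σf≡0 y))
        where
        f : Vec K n → ℤ
        f y = 𝟙 (shadow C y) * (+ 1 - sgnℕ (zeros y))
        f≥0 : ∀ y → + 0 ≤ f y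
        f≥0 y with shadow C y | evenℕ (zeros y)
        ... | true | true = +≤+ z≤n
        ... | true | false = +≤+ z≤n
        ... | false | _ = +≤+ z≤n
        Σf≡0 : sum n f ≡ + 0
        Σf≡0 = begin
          sum n f
            ≡⟨ sum-cong n (λ y → cong (λ s → 𝟙 (shadow C y) * (+ 1 - s)) (sgnℕ-zeros y)) ⟨
          sum n (λ y → 𝟙 (shadow C y) * (+ 1 - sgnℕ n * sgnWt y))
            ≡⟨ sum-cong n (λ y → expand (𝟙 (shadow C y)) (sgnℕ n) (sgnWt y)) ⟩
          sum n (λ y → 𝟙 (shadow C y) - sgnℕ n * (𝟙 (shadow C y) * sgnWt y))
            ≡⟨ sum-minus n _ _ ⟩
          size (shadow C) - sum n (λ y → sgnℕ n * (𝟙 (shadow C y) * sgnWt y))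
            ≡⟨ cong₂ _-_ size-shadow (sum-*ˡ n (sgnℕ n) _) ⟩
          (+ 2) ^ n - sgnℕ n * sum n (λ y → 𝟙 (shadow C y) * sgnWt y)
            ≡⟨ cong (λ s → (+ 2) ^ n - sgnℕ n * s) (trans sum-shadow-sgnWt (-2^n≡sgnℕ*2^n n)) ⟩
          (+ 2) ^ n - sgnℕ n * (sgnℕ n * (+ 2) ^ n)
            ≡⟨ cancel (sgnℕ n) ((+ 2) ^ n) (sgn*sgn≡1 (not (evenℕ n))) ⟩
          + 0 ∎
          where
          open ≡-Reasoning
          expand : ∀ b e s → b * (+ 1 - e * s) ≡ b - e * (b * s)
          expand = solve-∀
          cancel : ∀ e p → e * e ≡ + 1 → p - e * (e * p) ≡ + 0
          cancel e p e²≡1 = trans (regroup e p) (trans (cong (λ q → p - q * p) e²≡1) (vanish p))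
            where
            regroup : ∀ e p → p - e * (e * p) ≡ p - e * e * p
            regroup = solve-∀
            vanish : ∀ p → p - + 1 * p ≡ + 0
            vanish = solve-∀
        even : + 1 * (+ 1 - sgnℕ (zeros y)) ≡ + 0 → evenℕ (zeros y) ≡ true
        even with evenℕ (zeros y)
        ... | true = λ _ → refl
        ... | false = λ ()

      excess : ℤ
      excess = sum n (λ y → 𝟙 (shadow C y) * excessZeros (zeros y))

      16*excess : + 16 * excess ≡ (+ 2) ^ n * (+ (2 ℕ.* A₂) - + n * (+ 5 - + n))
      16*excess = begin
        + 16 * excess
          ≡⟨ cong (+ 16 *_) (trans (sum-cong n (λ y → split (𝟙 (shadow C y)) (+ zeros y))) (sum-minus n _ _)) ⟩
        + 16 * (ΣZ - Σz)
          ≡⟨ distrib ΣZ Σz ⟩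
        + 16 * ΣZ - + 4 * (+ 4 * Σz)
          ≡⟨ cong₂ (λ a b → a - + 4 * b) 16*sum-zeroPairs 4*sum-zeros ⟩
        (+ 2) ^ n * (+ n * (+ n - + 1) + + 2 * + A₂) - + 4 * (+ n * (+ 2) ^ n)
          ≡⟨ regroup ((+ 2) ^ n) (+ n) (+ A₂) ⟩
        (+ 2) ^ n * (+ 2 * + A₂ - + n * (+ 5 - + n))
          ≡⟨ cong (λ a → (+ 2) ^ n * (a - + n * (+ 5 - + n))) (ℤ.pos-* 2 A₂) ⟨
        (+ 2) ^ n * (+ (2 ℕ.* A₂) - + n * (+ 5 - + n)) ∎
        where
        open ≡-Reasoning
        ΣZ Σz : ℤ
        ΣZ = sum n (λ y → 𝟙 (shadow C y) * zeroPairs y)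
        Σz = sum n (λ y → 𝟙 (shadow C y) * + zeros y)
        split : ∀ s z → s * (z * (z - + 2)) ≡ s * (z * (z - + 1)) - s * z
        split = solve-∀
        distrib : ∀ a b → + 16 * (a - b) ≡ + 16 * a - + 4 * (+ 4 * b)
        distrib = solve-∀
        regroup : ∀ p m a → p * (m * (m - + 1) + + 2 * a) - + 4 * (m * p) ≡ p * (+ 2 * a - m * (+ 5 - m))
        regroup = solve-∀

      0≤excess-term : ∀ y → + 0 ≤ 𝟙 (shadow C y) * excessZeros (zeros y)
      0≤excess-term y with shadow C y in y∈S
      ... | false = +≤+ z≤n
      ... | true = subst (+ 0 ≤_) (sym (ℤ.*-identityˡ _))
                         (even⇒0≤excessZeros (zeros y) (shadow⇒even-zeros y y∈S))

      bound : + n * (+ 5 - + n) ≤ + (2 ℕ.* A₂)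
      bound = ℤ.0≤i-j⇒j≤i (ℤ.*-cancelˡ-≤-pos (+ 0) _ ((+ 2) ^ n) {{ℤ.positive (0<2^n n)}}
        (subst₂ _≤_ (sym (ℤ.*-zeroʳ ((+ 2) ^ n))) 16*excess
          (ℤ.*-monoˡ-≤-nonNeg (+ 16) (sum-nonneg n _ 0≤excess-term))))

      equality⇒excess≡0 : + (2 ℕ.* A₂) ≡ + n * (+ 5 - + n) → excess ≡ + 0
      equality⇒excess≡0 eq = ℤ.*-cancelˡ-≡ (+ 16) excess (+ 0) (begin
        + 16 * excess                                      ≡⟨ 16*excess ⟩
        (+ 2) ^ n * (+ (2 ℕ.* A₂) - + n * (+ 5 - + n))     ≡⟨ cong ((+ 2) ^ n *_) (ℤ.i≡j⇒i-j≡0 eq) ⟩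
        (+ 2) ^ n * + 0                                    ≡⟨ ℤ.*-zeroʳ ((+ 2) ^ n) ⟩
        + 0                                                ∎)
        where open ≡-Reasoning

      excess≡0⇒equality : excess ≡ + 0 → + (2 ℕ.* A₂) ≡ + n * (+ 5 - + n)
      excess≡0⇒equality excess≡0 = ℤ.i-j≡0⇒i≡j (+ (2 ℕ.* A₂)) (+ n * (+ 5 - + n))
        (2^n*-cancelˡ-≡ n (begin
          (+ 2) ^ n * (+ (2 ℕ.* A₂) - + n * (+ 5 - + n))  ≡⟨ 16*excess ⟨
          + 16 * excess                                   ≡⟨ cong (+ 16 *_) excess≡0 ⟩
          + 16 * + 0                                      ≡⟨ ℤ.*-zeroʳ ((+ 2) ^ n) ⟨
          (+ 2) ^ n * + 0                                 ∎))
        where open ≡-Reasoning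

      excess≡0⇒zeros≤2 : excess ≡ + 0 → ∀ y → shadow C y ≡ true → zeros y ℕ.≤ 2
      excess≡0⇒zeros≤2 excess≡0 y y∈S = excessZeros≡0⇒≤2 (zeros y)
        (trans (sym (ℤ.*-identityˡ _))
               (subst (λ b → 𝟙 b * excessZeros (zeros y) ≡ + 0) y∈S
                      (sum-nonneg≡0⇒≡0 n _ 0≤excess-term excess≡0 y)))

      zeros≤2⇒excess≡0 : (∀ y → shadow C y ≡ true → zeros y ℕ.≤ 2) → excess ≡ + 0
      zeros≤2⇒excess≡0 zeros≤2 = trans (sum-cong n vanish) (sum-0 n)
        where
        vanish : ∀ y → 𝟙 (shadow C y) * excessZeros (zeros y) ≡ + 0
        vanish y with shadow C y in y∈S
        ... | false = refl
        ... | true = trans (ℤ.*-identityˡ _)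
          (even-≤2⇒excessZeros≡0 (zeros y) (shadow⇒even-zeros y y∈S) (zeros≤2 y y∈S))

      module _ (1≤n : 1 ℕ.≤ n) (zeros≤2 : ∀ y → shadow C y ≡ true → zeros y ℕ.≤ 2) where

        -- every shadow word has 0 or 2 zeros, so zeros y counts the words of weight n ∸ 2 twice
        8*count-shadow : 8 ℕ.* numOfWeight (shadow C) (n ∸ 2) ≡ 2 ℕ.^ n ℕ.* n
        8*count-shadow = ℤ.+-injective (begin
          + (8 ℕ.* N)                                          ≡⟨ ℤ.pos-* 8 N ⟩
          + 8 * + N                                            ≡⟨ cong (+ 8 *_) (count-allVecs n _) ⟩
          + 8 * sum n (λ y → 𝟙 (shadow C y ∧ (wt y ℕ.≡ᵇ (n ∸ 2))))
            ≡⟨ trans (cong (+ 4 *_) (sum-*ˡ n (+ 2) _)) (double _) ⟨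
          + 4 * sum n (λ y → + 2 * 𝟙 (shadow C y ∧ (wt y ℕ.≡ᵇ (n ∸ 2))))
            ≡⟨ cong (+ 4 *_) (sum-cong n zeros-indicator) ⟨
          + 4 * sum n (λ y → 𝟙 (shadow C y) * + zeros y)       ≡⟨ 4*sum-zeros ⟩
          + n * (+ 2) ^ n                                      ≡⟨ cong (+ n *_) (pos-^ 2 n) ⟩
          + n * + (2 ℕ.^ n)                                    ≡⟨ ℤ.pos-* n (2 ℕ.^ n) ⟨
          + (n ℕ.* 2 ℕ.^ n)                                    ≡⟨ cong +_ (ℕ.*-comm n (2 ℕ.^ n)) ⟩
          + (2 ℕ.^ n ℕ.* n)                                    ∎)
          where
          open ≡-Reasoning
          N : ℕ
          N = numOfWeight (shadow C) (n ∸ 2)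
          double : ∀ a → + 4 * (+ 2 * a) ≡ + 8 * a
          double = solve-∀
          zeros-indicator : ∀ y → 𝟙 (shadow C y) * + zeros y ≡ + 2 * 𝟙 (shadow C y ∧ (wt y ℕ.≡ᵇ (n ∸ 2)))
          zeros-indicator y with shadow C y in y∈S
          ... | false = refl
          ... | true = trans (ℤ.*-identityˡ (+ zeros y))
            (zeros≡2*𝟙[wt≡length∸2] 1≤n y (even-≤2⇒0⊎2 (zeros y) (shadow⇒even-zeros y y∈S) (zeros≤2 y y∈S)))

        zeros≤2⇒minWeight : MinWeightIs (shadow C) (n ∸ 2)
        zeros≤2⇒minWeight = witness , λ y y∈S → zeros≤2⇒length∸2≤wt y (zeros≤2 y y∈S)
          where
          count≢0 : numOfWeight (shadow C) (n ∸ 2) ≢ 0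
          count≢0 N≡0 = [ ℕ.<⇒≢ (ℕ.m^n>0 2 n) ∘ sym , ℕ.<⇒≢ 1≤n ∘ sym ]′
            (ℕ.m*n≡0⇒m≡0∨n≡0 (2 ℕ.^ n) (trans (sym 8*count-shadow) (cong (8 ℕ.*_) N≡0)))
          weight-n∸2 : ∀ y → shadow C y ∧ (wt y ℕ.≡ᵇ (n ∸ 2)) ≡ true →
            (shadow C y ≡ true) × (wt y ≡ n ∸ 2)
          weight-n∸2 y test = ∧-conicalˡ (shadow C y) _ test ,
            ℕ.≡ᵇ⇒≡ (wt y) (n ∸ 2) (Equivalence.from T-≡ (∧-conicalʳ (shadow C y) _ test))
          witness : Σ _ λ y → (shadow C y ≡ true) × (wt y ≡ n ∸ 2)
          witness = let y , test = count≢0⇒∃ _ (allVecs n) count≢0 in y , weight-n∸2 y test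

open import Defs
open import Data.Nat using (ℕ; _≤_; _*_; _∸_; _^_)
open import Data.Integer using (+_; _-_) renaming (_*_ to _*ℤ_; _≤_ to _≤ℤ_)
open import Data.Bool using (true)
open import Data.Product using (_×_; _,_)
open import Function.Base using (_∘_)
open import Relation.Binary.PropositionalEquality using (_≡_; _≢_)
open import Function.Bundles using (_⇔_; mk⇔)
open KleinianShadow using (module SelfDualCode; zeros; minWeight⇒zeros≤2)

theorem14 : (n : ℕ) → 1 ≤ n → (C : Subset n) → IsLinearCode C → IsSelfDual C →
    (∀ x → C x ≡ true → wt x ≢ 1) →
    ((+ n) *ℤ (+ 5 - + n) ≤ℤ + (2 * numOfWeight C 2))
    × ((+ (2 * numOfWeight C 2) ≡ (+ n) *ℤ (+ 5 - + n)) ⇔ MinWeightIs (shadow C) (n ∸ 2))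
    × ((+ (2 * numOfWeight C 2) ≡ (+ n) *ℤ (+ 5 - + n)) →
        8 * numOfWeight (shadow C) (n ∸ 2) ≡ 2 ^ n * n)
theorem14 n 1≤n C lin sd no-wt-1 =
  bound ,
  mk⇔ (zeros≤2⇒minWeight 1≤n ∘ equality⇒zeros≤2)
      (excess≡0⇒equality ∘ zeros≤2⇒excess≡0 ∘ minWeight⇒zeros≤2 (shadow C)) ,
  8*count-shadow 1≤n ∘ equality⇒zeros≤2
  where
  open SelfDualCode C lin sd
  open NoWeightOne no-wt-1
  equality⇒zeros≤2 : + (2 * numOfWeight C 2) ≡ (+ n) *ℤ (+ 5 - + n) →
    ∀ y → shadow C y ≡ true → zeros y ≤ 2
  equality⇒zeros≤2 = excess≡0⇒zeros≤2 ∘ equality⇒excess≡0
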